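{- Let $n\geq 1$ and let $\phi(x_1,\ldots,x_n)$ be a first-order formula of Presburger arithmetic $FO(\mathbb{Z};<,+)$ with free variables $x_1,\ldots,x_n$. Then there exists a first-order formula $\psi(x_1,\ldots,x_{n-1},y)$ of $FO(\mathbb{Z};<,+)$ (i.e., using no counting quantifiers) such that for all integers $a_1,\ldots,a_{n-1},b$, the formula $\psi(a_1,\ldots,a_{n-1},b)$ holds in $\mathbb{Z}$ if and only if $\exists^{=y}_{x_n}\phi(x_1,\ldots,x_n)$ holds under the interpretation $x_i\mapsto a_i$ ($1\le i\le n-1$), $y\mapsto b$.
   Context: $FO(\mathbb{Z};<,+)$ denotes first-order logic over the structure $\langle \mathbb{Z};<,+\rangle$ (Presburger arithmetic over the integers, without multiplication). A unary counting quantifier is a construct $\exists^{=y}_{x}$ used as a prefix of a formula: the formula $\exists^{=y}_{x_n}\phi(x_1,\ldots,x_n)$ is true under the interpretation $a_1,\ldots,a_{n-1}$ for $x_1,\ldots,x_{n-1}$ and $b$ for $y$ if and only if the number of integers $a$ such that $\phi(a_1,\ldots,a_{n-1},a)$ holds is finite and equals $b$. For example, $\exists^{=y}_{x}(-1\le x\le 3)$ holds if and only if $y=5$. -}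

module Defs where

open import Data.Nat using (ℕ; zero; suc)
open import Data.Fin using (Fin; zero; suc; fromℕ; inject₁) renaming (_≟_ to _≟ᶠ_)
open import Data.Integer using (ℤ; +_) renaming (_+_ to _+ℤ_; _<_ to _<ℤ_)
open import Data.List using (List; length)
open import Data.List.Membership.Propositional using (_∈_)
open import Data.List.Relation.Unary.Unique.Propositional using (Unique)
open import Data.Product using (Σ; _×_; ∃)
open import Data.Sum using (_⊎_)
open import Data.Empty using (⊥)
open import Relation.Binary.PropositionalEquality using (_≡_)

-- Terms of the language ⟨<,+⟩ (no constants), variables as de Bruijn indices Fin n.
data Term (n : ℕ) : Set where
  var  : Fin n → Term n
  _⊕_  : Term n → Term n → Term n

data Formula (n : ℕ) : Set where
  _≐_ : Term n → Term n → Formula n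
  _≺_ : Term n → Term n → Formula n
  ⊤f  : Formula n
  ⊥f  : Formula n
  ¬f_ : Formula n → Formula n
  _∧f_ : Formula n → Formula n → Formula n
  _∨f_ : Formula n → Formula n → Formula n
  _⇒f_ : Formula n → Formula n → Formula n
  ∃f  : Formula (suc n) → Formula n   -- binds variable `zero`
  ∀f  : Formula (suc n) → Formula n   -- binds variable `zero`

Val : ℕ → Set
Val n = Fin n → ℤ

_∷ᵥ_ : ∀ {n} → ℤ → Val n → Val (suc n)
(a ∷ᵥ ρ) zero    = a
(a ∷ᵥ ρ) (suc i) = ρ i

-- extend a valuation at the end: the last variable (index n) gets value a
_∷ʳᵥ_ : ∀ {n} → Val n → ℤ → Val (suc n)
_∷ʳᵥ_ {zero}  ρ a zero    = a
_∷ʳᵥ_ {suc n} ρ a zero    = ρ zero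
_∷ʳᵥ_ {suc n} ρ a (suc i) = _∷ʳᵥ_ {n} (λ j → ρ (suc j)) a i

evalT : ∀ {n} → Term n → Val n → ℤ
evalT (var i) ρ = ρ i
evalT (s ⊕ t) ρ = evalT s ρ +ℤ evalT t ρ

⟦_⟧ : ∀ {n} → Formula n → Val n → Set
⟦ s ≐ t ⟧ ρ = evalT s ρ ≡ evalT t ρ
⟦ s ≺ t ⟧ ρ = evalT s ρ <ℤ evalT t ρ
⟦ ⊤f ⟧ ρ = Data.Unit.⊤ where import Data.Unit
⟦ ⊥f ⟧ ρ = ⊥
⟦ ¬f φ ⟧ ρ = ⟦ φ ⟧ ρ → ⊥
⟦ φ ∧f ψ ⟧ ρ = ⟦ φ ⟧ ρ × ⟦ ψ ⟧ ρ
⟦ φ ∨f ψ ⟧ ρ = ⟦ φ ⟧ ρ ⊎ ⟦ ψ ⟧ ρ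
⟦ φ ⇒f ψ ⟧ ρ = ⟦ φ ⟧ ρ → ⟦ ψ ⟧ ρ
⟦ ∃f φ ⟧ ρ = Σ ℤ λ a → ⟦ φ ⟧ (a ∷ᵥ ρ)
⟦ ∀f φ ⟧ ρ = (a : ℤ) → ⟦ φ ⟧ (a ∷ᵥ ρ)

CountIs : (ℤ → Set) → ℤ → Set
CountIs P b = Σ (List ℤ) λ xs →
  Unique xs × ((a : ℤ) → (P a → a ∈ xs) × (a ∈ xs → P a)) × (b ≡ + length xs)

-- Semantics of the unary counting quantifier ∃^{=y}_{x_n} φ(x_1,…,x_n),
-- evaluated at x_i ↦ as i (i < n-1) and y ↦ b; x_n is the last variable of φ.
CountQ : ∀ {m} → Formula (suc m) → Val m → ℤ → Set
CountQ φ as b = CountIs (λ a → ⟦ φ ⟧ (as ∷ʳᵥ a)) b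

-- Quantifier elimination (Cooper's method, with divisibility atoms) turns φ into a
-- quantifier-free θ(x, ā) in which, after scaling x, every coefficient of x is 0 or ±1 and
-- every modulus divides a fixed D. Cooper's step lemma then says: if θ(y) holds but
-- θ(y + D) fails, then y = u(ā) - j for one of finitely many terms u and some j < D.
-- A finite solution set therefore splits into maximal progressions y, y - D, y - 2D, …
-- whose tops lie among these candidate terms, and its size is the sum, over the distinct
-- candidates that are tops, of the lengths of their progressions. Boundedness of the set,
-- "e is a top", "c is the length of the progression below e" and "b is the sum of these
-- contributions" are first-order in ⟨ℤ; <, +⟩, which yields ψ. The counting identity
-- follows by telescoping run(y + D) = 𝟙[θ(y + D)]·(1 + run(y)) over an interval that
-- contains all solutions.

module Submission where

open import Data.Nat.Base as ℕ using (ℕ; zero; suc; z≤n; s≤s)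
import Data.Nat.Properties as ℕ
open import Data.Integer.Base using (ℤ; +_; -[1+_]; _+_; _*_; -_; _-_; _≤_; _<_; ∣_∣; +≤+; +<+; -≤+; nonNegative)
import Data.Integer.Properties as ℤ
open import Data.Integer.Divisibility.Signed
  using (_∣_; divides; _∣?_; *-monoʳ-∣; *-cancelˡ-∣; ∣m∣n⇒∣m+n; ∣n⇒∣m*n; ∣m+n∣n⇒∣m; ∣-trans)
open import Data.Integer.DivMod using (_%ℕ_; _/ℕ_; a≡a%ℕn+[a/ℕn]*n; n%ℕd<d)
open import Data.Integer.Tactic.RingSolver using (solve-∀)
open import Algebra.Properties.AbelianGroup ℤ.+-0-abelianGroup using (∙-cancelˡ; ∙-cancelʳ)
import Data.Nat.Tactic.RingSolver as ℕ-Solver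
open import Data.Fin.Base using (Fin; zero; suc; fromℕ; inject₁)
open import Data.Product.Base using (Σ; ∃; _×_; _,_; proj₁; proj₂)
open import Data.Sum.Base using (_⊎_; inj₁; inj₂)
open import Data.Empty using (⊥; ⊥-elim)
open import Data.Unit.Base using (⊤; tt)
open import Data.List.Base using (List; []; _∷_; _++_; map; length; concatMap; upTo)
import Data.List.Properties as List
open import Data.List.Relation.Unary.Any using (Any; here; there)
import Data.List.Relation.Unary.Any as Any
open import Data.List.Relation.Unary.Any.Properties using (++⁺ˡ; ++⁺ʳ)
import Data.List.Relation.Unary.All as All
open import Data.List.Relation.Unary.AllPairs using ([]; _∷_)
open import Data.List.Membership.Propositional using (_∈_; _∉_; _─_; find)
open import Data.List.Membership.DecPropositional ℤ._≟_ using (_∈?_)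
open import Data.List.Membership.Propositional.Properties using (∈-map⁺; ∈-map⁻; ∈-concatMap⁺; ∈-upTo⁺)
open import Data.List.Relation.Unary.Unique.Propositional using (Unique)
open import Data.List.Relation.Unary.Unique.Propositional.Properties using (map⁺)
open import Function.Base using (_∘_)
open import Function.Bundles using (_⇔_; mk⇔; Equivalence)
open import Function.Construct.Symmetry using (⇔-sym)
open import Function.Construct.Composition using (_⇔-∘_)
open import Function.Construct.Identity using (⇔-id)
open import Function.Related.TypeIsomorphisms using (→-cong-⇔; ¬-cong-⇔)
open import Function.Related.Propositional using (module EquationalReasoning)
open import Data.Product.Function.NonDependent.Propositional using (_×-⇔_)
open import Data.Sum.Function.Propositional using (_⊎-⇔_)
open import Relation.Nullary using (¬_; Dec; yes; no; does; ¬?; _×-dec_)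
open import Relation.Nullary.Decidable using (decidable-stable)
open import Data.Bool.Base using (if_then_else_)
open import Relation.Binary.Definitions using (Tri; tri<; tri≈; tri>)
open import Relation.Binary.PropositionalEquality
  using (_≡_; _≢_; refl; sym; trans; cong; cong₂; subst; module ≡-Reasoning)
open import Defs

open Equivalence using (to; from)

private
  variable
    m n k : ℕ

∃-cong-⇔ : {A : Set} {P Q : A → Set} → (∀ x → P x ⇔ Q x) → (∃ P) ⇔ (∃ Q)
∃-cong-⇔ P⇔Q = mk⇔ (λ (x , p) → x , to (P⇔Q x) p) (λ (x , q) → x , from (P⇔Q x) q)

Π-cong-⇔ : {A : Set} {P Q : A → Set} → (∀ x → P x ⇔ Q x) → (∀ x → P x) ⇔ (∀ x → Q x)
Π-cong-⇔ P⇔Q = mk⇔ (λ p x → to (P⇔Q x) (p x)) (λ q x → from (P⇔Q x) (q x))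

cong-⇔ : {A : Set} (P : A → Set) {x y : A} → x ≡ y → P x ⇔ P y
cong-⇔ P refl = ⇔-id _

cong₂-⇔ : {A B : Set} (R : A → B → Set) {x x′ : A} {y y′ : B} → x ≡ x′ → y ≡ y′ → R x y ⇔ R x′ y′
cong₂-⇔ R refl refl = ⇔-id _

→⇔¬⊎ : {A B : Set} → Dec A → (A → B) ⇔ (¬ A ⊎ B)
→⇔¬⊎ (yes a) = mk⇔ (λ f → inj₂ (f a)) λ { (inj₁ ¬a) a → ⊥-elim (¬a a) ; (inj₂ b) _ → b }
→⇔¬⊎ (no ¬a) = mk⇔ (λ _ → inj₁ ¬a)     λ { (inj₁ ¬a) a → ⊥-elim (¬a a) ; (inj₂ b) _ → b }

∀⇔¬∃¬ : {A : Set} {P : A → Set} → (∀ x → Dec (P x)) → (∀ x → P x) ⇔ (¬ ∃ λ x → ¬ P x)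
∀⇔¬∃¬ P? = mk⇔ (λ p (x , ¬px) → ¬px (p x)) λ ¬∃ x → decidable-stable (P? x) (λ ¬px → ¬∃ (x , ¬px))

-- A linear inequality is established by writing its slack as a sum of known nonnegative
-- terms; the identity between the two is then closed by the ring solver.
NonNeg : ℤ → Set
NonNeg x = + 0 ≤ x

≤⇒NonNeg : ∀ {a b} → a ≤ b → NonNeg (b - a)
≤⇒NonNeg = ℤ.i≤j⇒0≤j-i

NonNeg⇒≤ : ∀ {a b} → NonNeg (b - a) → a ≤ b
NonNeg⇒≤ = ℤ.0≤i-j⇒j≤i

private
  suc-slack : ∀ a b → b - (+ 1 + a) ≡ b - a - + 1
  suc-slack = solve-∀

<⇒NonNeg : ∀ {a b} → a < b → NonNeg (b - a - + 1)
<⇒NonNeg {a} {b} a<b = subst NonNeg (suc-slack a b) (≤⇒NonNeg (ℤ.i<j⇒suc[i]≤j a<b))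

NonNeg⇒< : ∀ {a b} → NonNeg (b - a - + 1) → a < b
NonNeg⇒< {a} {b} p = ℤ.suc[i]≤j⇒i<j (NonNeg⇒≤ (subst NonNeg (sym (suc-slack a b)) p))

≤-from-slack : ∀ {a b} e → e ≡ b - a → NonNeg e → a ≤ b
≤-from-slack e refl = NonNeg⇒≤

<-from-slack : ∀ {a b} e → e ≡ b - a - + 1 → NonNeg e → a < b
<-from-slack e refl = NonNeg⇒<

NonNeg-+ : ∀ {x y} → NonNeg x → NonNeg y → NonNeg (x + y)
NonNeg-+ = ℤ.+-mono-≤

NonNeg-* : ∀ {x y} → NonNeg x → NonNeg y → NonNeg (x * y)
NonNeg-* {x} {y} p q = subst (_≤ x * y) (ℤ.*-zeroʳ x) (ℤ.*-monoˡ-≤-nonNeg x ⦃ nonNegative p ⦄ q)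

NonNeg-ℕ : ∀ n → NonNeg (+ n)
NonNeg-ℕ n = +≤+ z≤n

NonNeg-∣∣- : ∀ x → NonNeg (+ ∣ x ∣ - x)
NonNeg-∣∣- (+ n) = subst NonNeg (sym (ℤ.+-inverseʳ (+ n))) (NonNeg-ℕ 0)
NonNeg-∣∣- -[1+ n ] = NonNeg-ℕ _

NonNeg-∣∣+ : ∀ x → NonNeg (+ ∣ x ∣ + x)
NonNeg-∣∣+ (+ n) = NonNeg-ℕ _
NonNeg-∣∣+ -[1+ n ] = subst NonNeg (sym (ℤ.+-inverseʳ (+ suc n))) (NonNeg-ℕ 0)

NonNeg-+-≢-[1+] : ∀ {x y} → NonNeg x → NonNeg y → x + y ≢ -[1+ n ]
NonNeg-+-≢-[1+] p q x+y≡ with subst NonNeg x+y≡ (NonNeg-+ p q)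
... | ()

-- Dense linear terms c₀·x₀ + c₁·x₁ + … + c, one coefficient per variable.
data Lin : ℕ → Set where
  cst  : ℤ → Lin zero
  _x+_ : ℤ → Lin n → Lin (suc n)

infixr 5 _x+_

tail : Val (suc n) → Val n
tail ρ = ρ ∘ suc

evalL : Lin n → Val n → ℤ
evalL (cst k)  ρ = k
evalL (c x+ t) ρ = c * ρ zero + evalL t (tail ρ)

constL : ℤ → Lin n
constL {zero}  k = cst k
constL {suc n} k = + 0 x+ constL k

varL : Fin n → Lin n
varL zero    = + 1 x+ constL (+ 0)
varL (suc i) = + 0 x+ varL i

infixl 6 _+L_ _-L_
infixl 7 _*L_

_+L_ : Lin n → Lin n → Lin n
cst a    +L cst b    = cst (a + b)
(c x+ s) +L (d x+ t) = (c + d) x+ (s +L t)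

_*L_ : ℤ → Lin n → Lin n
k *L cst a    = cst (k * a)
k *L (c x+ t) = (k * c) x+ (k *L t)

_-L_ : Lin n → Lin n → Lin n
s -L t = s +L (-[1+ 0 ] *L t)

substL : Lin n → (Fin n → Lin k) → Lin k
substL (cst a)  σ = constL a
substL (c x+ t) σ = c *L σ zero +L substL t (σ ∘ suc)

wkL : Lin n → Lin (suc n)
wkL t = substL t (varL ∘ suc)

evalL-const : ∀ a (ρ : Val n) → evalL (constL a) ρ ≡ a
evalL-const {zero}  a ρ = refl
evalL-const {suc n} a ρ = trans (cong (_+_ (+ 0 * ρ zero)) (evalL-const a (tail ρ))) (lemma (ρ zero) a)
  where lemma : ∀ x a → + 0 * x + a ≡ a
        lemma = solve-∀

evalL-+ : ∀ (s t : Lin n) ρ → evalL (s +L t) ρ ≡ evalL s ρ + evalL t ρ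
evalL-+ (cst a)  (cst b)  ρ = refl
evalL-+ (c x+ s) (d x+ t) ρ =
  trans (cong (_+_ ((c + d) * ρ zero)) (evalL-+ s t (tail ρ)))
        (lemma c d (ρ zero) (evalL s (tail ρ)) (evalL t (tail ρ)))
  where lemma : ∀ c d x u v → (c + d) * x + (u + v) ≡ (c * x + u) + (d * x + v)
        lemma = solve-∀

evalL-* : ∀ k (t : Lin n) ρ → evalL (k *L t) ρ ≡ k * evalL t ρ
evalL-* k (cst a)  ρ = refl
evalL-* k (c x+ t) ρ =
  trans (cong (_+_ (k * c * ρ zero)) (evalL-* k t (tail ρ))) (lemma k c (ρ zero) (evalL t (tail ρ)))
  where lemma : ∀ k c x u → k * c * x + k * u ≡ k * (c * x + u)
        lemma = solve-∀

evalL-- : ∀ (s t : Lin n) ρ → evalL (s -L t) ρ ≡ evalL s ρ - evalL t ρ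
evalL-- s t ρ =
  trans (evalL-+ s _ ρ) (trans (cong (_+_ (evalL s ρ)) (evalL-* -[1+ 0 ] t ρ)) (lemma (evalL s ρ) (evalL t ρ)))
  where lemma : ∀ a b → a + -[1+ 0 ] * b ≡ a - b
        lemma = solve-∀

evalL-var : ∀ (i : Fin n) ρ → evalL (varL i) ρ ≡ ρ i
evalL-var zero ρ =
  trans (cong (_+_ (+ 1 * ρ zero)) (evalL-const (+ 0) (tail ρ))) (lemma (ρ zero))
  where lemma : ∀ x → + 1 * x + + 0 ≡ x
        lemma = solve-∀
evalL-var (suc i) ρ =
  trans (cong (_+_ (+ 0 * ρ zero)) (evalL-var i (tail ρ))) (lemma (ρ zero) (ρ (suc i)))
  where lemma : ∀ x y → + 0 * x + y ≡ y
        lemma = solve-∀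

evalL-cong : ∀ (t : Lin n) {ρ ρ′} → (∀ i → ρ i ≡ ρ′ i) → evalL t ρ ≡ evalL t ρ′
evalL-cong (cst a)  ρ≗ρ′ = refl
evalL-cong (c x+ t) ρ≗ρ′ = cong₂ (λ x y → c * x + y) (ρ≗ρ′ zero) (evalL-cong t (ρ≗ρ′ ∘ suc))

evalL-subst : ∀ (t : Lin n) (σ : Fin n → Lin k) ρ →
              evalL (substL t σ) ρ ≡ evalL t (λ i → evalL (σ i) ρ)
evalL-subst (cst a)  σ ρ = evalL-const a ρ
evalL-subst (c x+ t) σ ρ =
  trans (evalL-+ (c *L σ zero) _ ρ) (cong₂ _+_ (evalL-* c (σ zero) ρ) (evalL-subst t (σ ∘ suc) ρ))

evalL-wk : ∀ (t : Lin n) a ρ → evalL (wkL t) (a ∷ᵥ ρ) ≡ evalL t ρ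
evalL-wk t a ρ = trans (evalL-subst t _ (a ∷ᵥ ρ)) (evalL-cong t (λ i → evalL-var (suc i) (a ∷ᵥ ρ)))

-- The modulus of a divisibility atom is stored shifted by one: dvd k t means (k + 1) ∣ t.
data QF (n : ℕ) : Set where
  ⊤q ⊥q     : QF n
  0<_       : Lin n → QF n
  dvd ndvd  : ℕ → Lin n → QF n
  _∧q_ _∨q_ : QF n → QF n → QF n

infixr 3 _∧q_
infixr 2 _∨q_

Divides : ℕ → ℤ → Set
Divides k a = + suc k ∣ a

⟦_⟧q : QF n → Val n → Set
⟦ ⊤q ⟧q       ρ = ⊤
⟦ ⊥q ⟧q       ρ = ⊥
⟦ 0< t ⟧q     ρ = + 0 < evalL t ρ
⟦ dvd k t ⟧q  ρ = Divides k (evalL t ρ)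
⟦ ndvd k t ⟧q ρ = ¬ Divides k (evalL t ρ)
⟦ θ ∧q ψ ⟧q   ρ = ⟦ θ ⟧q ρ × ⟦ ψ ⟧q ρ
⟦ θ ∨q ψ ⟧q   ρ = ⟦ θ ⟧q ρ ⊎ ⟦ ψ ⟧q ρ

⟦_⟧q? : (θ : QF n) (ρ : Val n) → Dec (⟦ θ ⟧q ρ)
⟦ ⊤q ⟧q?       ρ = yes tt
⟦ ⊥q ⟧q?       ρ = no λ ()
⟦ 0< t ⟧q?     ρ = + 0 ℤ.<? evalL t ρ
⟦ dvd k t ⟧q?  ρ = + suc k ∣? evalL t ρ
⟦ ndvd k t ⟧q? ρ with + suc k ∣? evalL t ρ
... | yes k∣t = no λ k∤t → k∤t k∣t
... | no  k∤t = yes k∤t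
⟦ θ ∧q ψ ⟧q?   ρ with ⟦ θ ⟧q? ρ | ⟦ ψ ⟧q? ρ
... | yes p | yes q = yes (p , q)
... | no ¬p | _     = no (¬p ∘ proj₁)
... | yes _ | no ¬q = no (¬q ∘ proj₂)
⟦ θ ∨q ψ ⟧q?   ρ with ⟦ θ ⟧q? ρ | ⟦ ψ ⟧q? ρ
... | yes p | _     = yes (inj₁ p)
... | no _  | yes q = yes (inj₂ q)
... | no ¬p | no ¬q = no λ { (inj₁ p) → ¬p p ; (inj₂ q) → ¬q q }

negateQ : QF n → QF n
negateQ ⊤q         = ⊥q
negateQ ⊥q         = ⊤q
negateQ (0< t)     = 0< (constL (+ 1) -L t)
negateQ (dvd k t)  = ndvd k t
negateQ (ndvd k t) = dvd k t
negateQ (θ ∧q ψ)   = negateQ θ ∨q negateQ ψ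
negateQ (θ ∨q ψ)   = negateQ θ ∧q negateQ ψ

0<1-x⇔x≯0 : ∀ x → + 0 < + 1 - x ⇔ (¬ + 0 < x)
0<1-x⇔x≯0 x = mk⇔
  (λ 0<1-x 0<x → NonNeg-+-≢-[1+] (<⇒NonNeg 0<1-x) (<⇒NonNeg 0<x) (slack-sum x))
  (λ x≯0 → <-from-slack (+ 0 - x) (slack x) (≤⇒NonNeg (ℤ.≮⇒≥ x≯0)))
  where
    slack-sum : ∀ x → (+ 1 - x - + 0 - + 1) + (x - + 0 - + 1) ≡ -[1+ 0 ]
    slack-sum = solve-∀
    slack : ∀ x → + 0 - x ≡ + 1 - x - + 0 - + 1
    slack = solve-∀

negateQ-correct : ∀ (θ : QF n) ρ → ⟦ negateQ θ ⟧q ρ ⇔ (¬ ⟦ θ ⟧q ρ)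
negateQ-correct ⊤q ρ = mk⇔ (λ ()) (λ ¬⊤ → ¬⊤ tt)
negateQ-correct ⊥q ρ = mk⇔ (λ _ ()) (λ _ → tt)
negateQ-correct (0< t) ρ = 0<1-x⇔x≯0 (evalL t ρ) ⇔-∘ cong-⇔ (+ 0 <_) 1-t≡
  where 1-t≡ = trans (evalL-- (constL (+ 1)) t ρ) (cong (_- evalL t ρ) (evalL-const (+ 1) ρ))
negateQ-correct (dvd k t) ρ = ⇔-id _
negateQ-correct (ndvd k t) ρ with + suc k ∣? evalL t ρ
... | yes k∣t = mk⇔ (λ k∣t k∤t → k∤t k∣t) (λ _ → k∣t)
... | no  k∤t = mk⇔ (λ k∣t k∤t → k∤t k∣t) (λ ¬k∤t → ⊥-elim (¬k∤t k∤t))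
negateQ-correct (θ ∧q ψ) ρ = mk⇔ to′ from′
  where
    to′ : ⟦ negateQ θ ∨q negateQ ψ ⟧q ρ → ¬ (⟦ θ ⟧q ρ × ⟦ ψ ⟧q ρ)
    to′ (inj₁ ¬θ) (p , _) = to (negateQ-correct θ ρ) ¬θ p
    to′ (inj₂ ¬ψ) (_ , q) = to (negateQ-correct ψ ρ) ¬ψ q
    from′ : ¬ (⟦ θ ⟧q ρ × ⟦ ψ ⟧q ρ) → ⟦ negateQ θ ∨q negateQ ψ ⟧q ρ
    from′ ¬θψ with ⟦ θ ⟧q? ρ
    ... | no ¬p = inj₁ (from (negateQ-correct θ ρ) ¬p)
    ... | yes p = inj₂ (from (negateQ-correct ψ ρ) (λ q → ¬θψ (p , q)))
negateQ-correct (θ ∨q ψ) ρ = mk⇔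
  (λ (¬θ , ¬ψ) → λ { (inj₁ p) → to (negateQ-correct θ ρ) ¬θ p ; (inj₂ q) → to (negateQ-correct ψ ρ) ¬ψ q })
  (λ ¬θψ → from (negateQ-correct θ ρ) (¬θψ ∘ inj₁) , from (negateQ-correct ψ ρ) (¬θψ ∘ inj₂))

⟦⟧q-resp : ∀ (θ : QF n) {ρ ρ′} → (∀ i → ρ i ≡ ρ′ i) → ⟦ θ ⟧q ρ → ⟦ θ ⟧q ρ′
⟦⟧q-resp ⊤q         ρ≗ρ′ p = p
⟦⟧q-resp (0< t)     ρ≗ρ′ p = subst (+ 0 <_) (evalL-cong t ρ≗ρ′) p
⟦⟧q-resp (dvd k t)  ρ≗ρ′ p = subst (Divides k) (evalL-cong t ρ≗ρ′) p
⟦⟧q-resp (ndvd k t) ρ≗ρ′ p = p ∘ subst (Divides k) (sym (evalL-cong t ρ≗ρ′))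
⟦⟧q-resp (θ ∧q ψ)   ρ≗ρ′ (p , q) = ⟦⟧q-resp θ ρ≗ρ′ p , ⟦⟧q-resp ψ ρ≗ρ′ q
⟦⟧q-resp (θ ∨q ψ)   ρ≗ρ′ (inj₁ p) = inj₁ (⟦⟧q-resp θ ρ≗ρ′ p)
⟦⟧q-resp (θ ∨q ψ)   ρ≗ρ′ (inj₂ q) = inj₂ (⟦⟧q-resp ψ ρ≗ρ′ q)

⟦⟧q-cong : ∀ (θ : QF n) {ρ ρ′} → (∀ i → ρ i ≡ ρ′ i) → ⟦ θ ⟧q ρ ⇔ ⟦ θ ⟧q ρ′
⟦⟧q-cong θ ρ≗ρ′ = mk⇔ (⟦⟧q-resp θ ρ≗ρ′) (⟦⟧q-resp θ (sym ∘ ρ≗ρ′))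

substQ : QF n → (Fin n → Lin k) → QF k
substQ ⊤q         σ = ⊤q
substQ ⊥q         σ = ⊥q
substQ (0< t)     σ = 0< substL t σ
substQ (dvd k t)  σ = dvd k (substL t σ)
substQ (ndvd k t) σ = ndvd k (substL t σ)
substQ (θ ∧q ψ)   σ = substQ θ σ ∧q substQ ψ σ
substQ (θ ∨q ψ)   σ = substQ θ σ ∨q substQ ψ σ

substQ-correct : ∀ (θ : QF n) (σ : Fin n → Lin k) ρ →
                 ⟦ substQ θ σ ⟧q ρ ⇔ ⟦ θ ⟧q (λ i → evalL (σ i) ρ)
substQ-correct ⊤q         σ ρ = ⇔-id _
substQ-correct ⊥q         σ ρ = ⇔-id _
substQ-correct (0< t)     σ ρ = cong-⇔ (+ 0 <_) (evalL-subst t σ ρ)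
substQ-correct (dvd k t)  σ ρ = cong-⇔ (Divides k) (evalL-subst t σ ρ)
substQ-correct (ndvd k t) σ ρ = ¬-cong-⇔ (cong-⇔ (Divides k) (evalL-subst t σ ρ))
substQ-correct (θ ∧q ψ)   σ ρ = substQ-correct θ σ ρ ×-⇔ substQ-correct ψ σ ρ
substQ-correct (θ ∨q ψ)   σ ρ = substQ-correct θ σ ρ ⊎-⇔ substQ-correct ψ σ ρ

substZero : Lin n → Fin (suc n) → Lin n
substZero u zero    = u
substZero u (suc i) = varL i

_[_] : QF (suc n) → Lin n → QF n
θ [ u ] = substQ θ (substZero u)

[]-correct : ∀ (θ : QF (suc n)) u ρ → ⟦ θ [ u ] ⟧q ρ ⇔ ⟦ θ ⟧q (evalL u ρ ∷ᵥ ρ)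
[]-correct θ u ρ = ⟦⟧q-cong θ pointwise ⇔-∘ substQ-correct θ (substZero u) ρ
  where
    pointwise : ∀ i → evalL (substZero u i) ρ ≡ (evalL u ρ ∷ᵥ ρ) i
    pointwise zero    = refl
    pointwise (suc i) = evalL-var i ρ

⋁< : ℕ → (ℕ → QF n) → QF n
⋁< zero    f = ⊥q
⋁< (suc k) f = f k ∨q ⋁< k f

⋁<-correct : ∀ k (f : ℕ → QF n) ρ → ⟦ ⋁< k f ⟧q ρ ⇔ (∃ λ j → j ℕ.< k × ⟦ f j ⟧q ρ)
⋁<-correct zero f ρ = mk⇔ (λ ()) (λ { (_ , () , _) })
⋁<-correct (suc k) f ρ = mk⇔ to′ from′
  where
    to′ : ⟦ ⋁< (suc k) f ⟧q ρ → ∃ λ j → j ℕ.< suc k × ⟦ f j ⟧q ρ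
    to′ (inj₁ p) = k , ℕ.≤-refl , p
    to′ (inj₂ q) with to (⋁<-correct k f ρ) q
    ... | j , j<k , p = j , ℕ.m≤n⇒m≤1+n j<k , p
    from′ : (∃ λ j → j ℕ.< suc k × ⟦ f j ⟧q ρ) → ⟦ ⋁< (suc k) f ⟧q ρ
    from′ (j , j≤k , p) with j ℕ.≟ k
    ... | yes refl = inj₁ p
    ... | no  j≢k  = inj₂ (from (⋁<-correct k f ρ) (j , ℕ.≤∧≢⇒< (ℕ.≤-pred j≤k) j≢k , p))

⋁∈ : {A : Set} → List A → (A → QF n) → QF n
⋁∈ []       f = ⊥q
⋁∈ (a ∷ as) f = f a ∨q ⋁∈ as f

⋁∈-correct : ∀ {A : Set} (as : List A) (f : A → QF n) ρ → ⟦ ⋁∈ as f ⟧q ρ ⇔ Any (λ a → ⟦ f a ⟧q ρ) as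
⋁∈-correct []       f ρ = mk⇔ (λ ()) (λ ())
⋁∈-correct (a ∷ as) f ρ = mk⇔
  (λ { (inj₁ p) → here p ; (inj₂ q) → there (to (⋁∈-correct as f ρ) q) })
  (λ { (here p) → inj₁ p ; (there q) → inj₂ (from (⋁∈-correct as f ρ) q) })

-- Making the coefficient of the eliminated variable a unit

-- Positive multipliers are represented by their predecessors: m stands for m + 1, and
-- mul⁺ is multiplication of the represented numbers.
mul⁺ : ℕ → ℕ → ℕ
mul⁺ a b = b ℕ.+ a ℕ.* suc b

mul⁺-correct : ∀ a b → + suc (mul⁺ a b) ≡ + suc a * + suc b
mul⁺-correct a b = sym (ℤ.pos-* (suc a) (suc b))

absPred : ℤ → ℕ
absPred (+ zero)  = zero
absPred (+ suc k) = k
absPred -[1+ k ]  = k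

sign : ℤ → ℤ
sign (+ zero)  = + 0
sign (+ suc k) = + 1
sign -[1+ k ]  = -[1+ 0 ]

sign*absPred : ∀ c → sign c * + suc (absPred c) ≡ c
sign*absPred (+ zero)  = refl
sign*absPred (+ suc k) = ℤ.*-identityˡ (+ suc k)
sign*absPred -[1+ k ]  = ℤ.-1*i≡-i (+ suc k)

coeff : Lin (suc n) → ℤ
coeff (c x+ t) = c

scale : QF (suc n) → ℕ
scale (0< s)     = absPred (coeff s)
scale (dvd k s)  = absPred (coeff s)
scale (ndvd k s) = absPred (coeff s)
scale (θ ∧q ψ)   = mul⁺ (scale θ) (scale ψ)
scale (θ ∨q ψ)   = mul⁺ (scale θ) (scale ψ)
scale _          = 0

-- normalise θ F multiplies every atom of θ by F + 1 times the product of the other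
-- atoms' coefficients of x; when (F + 1)(scale θ + 1) = L + 1, every coefficient of x
-- becomes ±(L + 1) (or stays 0), and (L + 1)·x is renamed to x.
normaliseL : ℕ → Lin (suc n) → Lin (suc n)
normaliseL F (c x+ t) = sign c x+ (+ suc F *L t)

normalise : QF (suc n) → ℕ → QF (suc n)
normalise ⊤q         F = ⊤q
normalise ⊥q         F = ⊥q
normalise (0< s)     F = 0< normaliseL F s
normalise (dvd k s)  F = dvd (mul⁺ F k) (normaliseL F s)
normalise (ndvd k s) F = ndvd (mul⁺ F k) (normaliseL F s)
normalise (θ ∧q ψ)   F = normalise θ (mul⁺ F (scale ψ)) ∧q normalise ψ (mul⁺ F (scale θ))
normalise (θ ∨q ψ)   F = normalise θ (mul⁺ F (scale ψ)) ∨q normalise ψ (mul⁺ F (scale θ))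

normaliseL-correct : ∀ F L (s : Lin (suc n)) → suc F ℕ.* suc (absPred (coeff s)) ≡ suc L →
                     ∀ x ρ → evalL (normaliseL F s) ((+ suc L * x) ∷ᵥ ρ) ≡ + suc F * evalL s (x ∷ᵥ ρ)
normaliseL-correct F L (c x+ t) FL≡ x ρ = begin
  sign c * (+ suc L * x) + evalL (+ suc F *L t) ρ
    ≡⟨ cong₂ (λ a b → sign c * (a * x) + b) (sym FL≡ℤ) (evalL-* (+ suc F) t ρ) ⟩
  sign c * (+ suc F * + suc (absPred c) * x) + + suc F * evalL t ρ
    ≡⟨ lemma (sign c) (+ suc F) (+ suc (absPred c)) x (evalL t ρ) ⟩
  + suc F * (sign c * + suc (absPred c) * x + evalL t ρ)
    ≡⟨ cong (λ z → + suc F * (z * x + evalL t ρ)) (sign*absPred c) ⟩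
  + suc F * (c * x + evalL t ρ) ∎
  where
    open ≡-Reasoning
    FL≡ℤ : + suc F * + suc (absPred c) ≡ + suc L
    FL≡ℤ = trans (sym (ℤ.pos-* (suc F) (suc (absPred c)))) (cong +_ FL≡)
    lemma : ∀ g m a x e → g * (m * a * x) + m * e ≡ m * (g * a * x + e)
    lemma = solve-∀

0<⇔0<* : ∀ m a → + 0 < a ⇔ + 0 < + suc m * a
0<⇔0<* m a = mk⇔
  (λ 0<a → subst (_< + suc m * a) (ℤ.*-zeroʳ (+ suc m)) (ℤ.*-monoˡ-<-pos (+ suc m) 0<a))
  (λ 0<ma → ℤ.*-cancelˡ-<-nonNeg (+ suc m) (subst (_< + suc m * a) (sym (ℤ.*-zeroʳ (+ suc m))) 0<ma))

Divides⇔Divides-* : ∀ m k a → Divides k a ⇔ Divides (mul⁺ m k) (+ suc m * a)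
Divides⇔Divides-* m k a = mk⇔
  (λ k∣a → subst (_∣ (+ suc m * a)) (sym (mul⁺-correct m k)) (*-monoʳ-∣ (+ suc m) k∣a))
  (λ mk∣ma → *-cancelˡ-∣ (+ suc m) (subst (_∣ (+ suc m * a)) (mul⁺-correct m k) mk∣ma))

private
  mul⁺-splitˡ : ∀ F a b → suc (b ℕ.+ F ℕ.* suc b) ℕ.* suc a ≡ suc F ℕ.* suc (b ℕ.+ a ℕ.* suc b)
  mul⁺-splitˡ = ℕ-Solver.solve-∀

  mul⁺-splitʳ : ∀ F a b → suc (a ℕ.+ F ℕ.* suc a) ℕ.* suc b ≡ suc F ℕ.* suc (b ℕ.+ a ℕ.* suc b)
  mul⁺-splitʳ = ℕ-Solver.solve-∀

normalise-correct : ∀ (θ : QF (suc n)) F L → suc F ℕ.* suc (scale θ) ≡ suc L → ∀ x ρ →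
                    ⟦ θ ⟧q (x ∷ᵥ ρ) ⇔ ⟦ normalise θ F ⟧q ((+ suc L * x) ∷ᵥ ρ)
normalise-correct ⊤q F L FL≡ x ρ = ⇔-id _
normalise-correct ⊥q F L FL≡ x ρ = ⇔-id _
normalise-correct (0< s) F L FL≡ x ρ
  rewrite normaliseL-correct F L s FL≡ x ρ = 0<⇔0<* F _
normalise-correct (dvd k s) F L FL≡ x ρ
  rewrite normaliseL-correct F L s FL≡ x ρ = Divides⇔Divides-* F k _
normalise-correct (ndvd k s) F L FL≡ x ρ
  rewrite normaliseL-correct F L s FL≡ x ρ = ¬-cong-⇔ (Divides⇔Divides-* F k _)
normalise-correct (θ ∧q ψ) F L FL≡ x ρ =
  normalise-correct θ _ L (trans (mul⁺-splitˡ F (scale θ) (scale ψ)) FL≡) x ρ ×-⇔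
  normalise-correct ψ _ L (trans (mul⁺-splitʳ F (scale θ) (scale ψ)) FL≡) x ρ
normalise-correct (θ ∨q ψ) F L FL≡ x ρ =
  normalise-correct θ _ L (trans (mul⁺-splitˡ F (scale θ) (scale ψ)) FL≡) x ρ ⊎-⇔
  normalise-correct ψ _ L (trans (mul⁺-splitʳ F (scale θ) (scale ψ)) FL≡) x ρ

unitForm : QF (suc n) → QF (suc n)
unitForm θ = dvd (scale θ) (varL zero) ∧q normalise θ 0

unitForm-correct : ∀ (θ : QF (suc n)) y ρ →
                   ⟦ unitForm θ ⟧q (y ∷ᵥ ρ) ⇔ (∃ λ x → y ≡ + suc (scale θ) * x × ⟦ θ ⟧q (x ∷ᵥ ρ))
unitForm-correct θ y ρ = mk⇔ to′ from′
  where
    L = + suc (scale θ)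
    θ⇔ : ∀ x → ⟦ θ ⟧q (x ∷ᵥ ρ) ⇔ ⟦ normalise θ 0 ⟧q ((L * x) ∷ᵥ ρ)
    θ⇔ x = normalise-correct θ 0 (scale θ) (ℕ.*-identityˡ _) x ρ
    var₀ : ∀ y → evalL {suc _} (varL zero) (y ∷ᵥ ρ) ≡ y
    var₀ y = evalL-var zero (y ∷ᵥ ρ)
    to′ : ⟦ unitForm θ ⟧q (y ∷ᵥ ρ) → ∃ λ x → y ≡ L * x × ⟦ θ ⟧q (x ∷ᵥ ρ)
    to′ (divides x y≡x*L , p) = x , y≡L*x , from (θ⇔ x) (subst (λ z → ⟦ normalise θ 0 ⟧q (z ∷ᵥ ρ)) y≡L*x p)
      where y≡L*x = trans (sym (var₀ y)) (trans y≡x*L (ℤ.*-comm x L))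
    from′ : (∃ λ x → y ≡ L * x × ⟦ θ ⟧q (x ∷ᵥ ρ)) → ⟦ unitForm θ ⟧q (y ∷ᵥ ρ)
    from′ (x , refl , p) = divides x (trans (var₀ _) (ℤ.*-comm L x)) , to (θ⇔ x) p

-- Cooper's elimination of one existential quantifier

modulus : QF n → ℕ
modulus (dvd k s)  = k
modulus (ndvd k s) = k
modulus (θ ∧q ψ)   = mul⁺ (modulus θ) (modulus ψ)
modulus (θ ∨q ψ)   = mul⁺ (modulus θ) (modulus ψ)
modulus _          = 0

ModuliDivide : ℤ → QF n → Set
ModuliDivide D (dvd k s)  = + suc k ∣ D
ModuliDivide D (ndvd k s) = + suc k ∣ D
ModuliDivide D (θ ∧q ψ)   = ModuliDivide D θ × ModuliDivide D ψ
ModuliDivide D (θ ∨q ψ)   = ModuliDivide D θ × ModuliDivide D ψ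
ModuliDivide D _          = ⊤

ModuliDivide-∣ : ∀ (θ : QF n) {D E} → ModuliDivide D θ → D ∣ E → ModuliDivide E θ
ModuliDivide-∣ ⊤q         _ _ = tt
ModuliDivide-∣ ⊥q         _ _ = tt
ModuliDivide-∣ (0< _)     _ _ = tt
ModuliDivide-∣ (dvd k s)  k∣D D∣E = ∣-trans k∣D D∣E
ModuliDivide-∣ (ndvd k s) k∣D D∣E = ∣-trans k∣D D∣E
ModuliDivide-∣ (θ ∧q ψ) (θ∣D , ψ∣D) D∣E = ModuliDivide-∣ θ θ∣D D∣E , ModuliDivide-∣ ψ ψ∣D D∣E
ModuliDivide-∣ (θ ∨q ψ) (θ∣D , ψ∣D) D∣E = ModuliDivide-∣ θ θ∣D D∣E , ModuliDivide-∣ ψ ψ∣D D∣E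

private
  suc∣mul⁺ˡ : ∀ a b → + suc a ∣ + suc (mul⁺ a b)
  suc∣mul⁺ˡ a b = divides (+ suc b) (trans (mul⁺-correct a b) (ℤ.*-comm (+ suc a) (+ suc b)))

  suc∣mul⁺ʳ : ∀ a b → + suc b ∣ + suc (mul⁺ a b)
  suc∣mul⁺ʳ a b = divides (+ suc a) (mul⁺-correct a b)

moduliDivide-modulus : ∀ (θ : QF n) → ModuliDivide (+ suc (modulus θ)) θ
moduliDivide-modulus ⊤q         = tt
moduliDivide-modulus ⊥q         = tt
moduliDivide-modulus (0< _)     = tt
moduliDivide-modulus (dvd k s)  = divides (+ 1) (sym (ℤ.*-identityˡ _))
moduliDivide-modulus (ndvd k s) = divides (+ 1) (sym (ℤ.*-identityˡ _))
moduliDivide-modulus (θ ∧q ψ) =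
  ModuliDivide-∣ θ (moduliDivide-modulus θ) (suc∣mul⁺ˡ (modulus θ) (modulus ψ)) ,
  ModuliDivide-∣ ψ (moduliDivide-modulus ψ) (suc∣mul⁺ʳ (modulus θ) (modulus ψ))
moduliDivide-modulus (θ ∨q ψ) =
  ModuliDivide-∣ θ (moduliDivide-modulus θ) (suc∣mul⁺ˡ (modulus θ) (modulus ψ)) ,
  ModuliDivide-∣ ψ (moduliDivide-modulus ψ) (suc∣mul⁺ʳ (modulus θ) (modulus ψ))

Normalised : QF (suc n) → Set
Normalised (0< (c x+ t)) = c ≡ -[1+ 0 ] ⊎ NonNeg c
Normalised (θ ∧q ψ)      = Normalised θ × Normalised ψ
Normalised (θ ∨q ψ)      = Normalised θ × Normalised ψ
Normalised _             = ⊤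

normalise-normalised : ∀ (θ : QF (suc n)) F → Normalised (normalise θ F)
normalise-normalised (0< (+ zero  x+ t)) F = inj₂ (NonNeg-ℕ 0)
normalise-normalised (0< (+ suc k x+ t)) F = inj₂ (NonNeg-ℕ 1)
normalise-normalised (0< (-[1+ k ] x+ t)) F = inj₁ refl
normalise-normalised ⊤q         F = tt
normalise-normalised ⊥q         F = tt
normalise-normalised (dvd k s)  F = tt
normalise-normalised (ndvd k s) F = tt
normalise-normalised (θ ∧q ψ)   F = normalise-normalised θ _ , normalise-normalised ψ _
normalise-normalised (θ ∨q ψ)   F = normalise-normalised θ _ , normalise-normalised ψ _

-- For a normalised θ, an atom 0 < -x + t is the upper bound x ≤ t - 1; these are the
-- boundary points at which θ may stop being satisfied when x moves up.
boundaryPoints : QF (suc n) → List (Lin n)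
boundaryPoints (0< (-[1+ k ] x+ t)) = t -L constL (+ 1) ∷ []
boundaryPoints (θ ∧q ψ)             = boundaryPoints θ ++ boundaryPoints ψ
boundaryPoints (θ ∨q ψ)             = boundaryPoints θ ++ boundaryPoints ψ
boundaryPoints _                    = []

atInfinity : QF (suc n) → QF (suc n)
atInfinity (0< (+ zero  x+ t))  = 0< (+ zero x+ t)
atInfinity (0< (+ suc k x+ t))  = ⊤q
atInfinity (0< (-[1+ k ] x+ t)) = ⊥q
atInfinity (θ ∧q ψ)             = atInfinity θ ∧q atInfinity ψ
atInfinity (θ ∨q ψ)             = atInfinity θ ∨q atInfinity ψ
atInfinity θ                    = θ

threshold : QF (suc n) → Val n → ℕ
threshold (0< (c x+ t)) ρ = ∣ evalL t ρ ∣
threshold (θ ∧q ψ)      ρ = threshold θ ρ ℕ.+ threshold ψ ρ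
threshold (θ ∨q ψ)      ρ = threshold θ ρ ℕ.+ threshold ψ ρ
threshold _             ρ = 0

evalL-minusConst : ∀ (t : Lin n) j ρ → evalL (t -L constL j) ρ ≡ evalL t ρ - j
evalL-minusConst t j ρ = trans (evalL-- t (constL j) ρ) (cong (_-_ (evalL t ρ)) (evalL-const j ρ))

NearBoundary : ℕ → QF (suc n) → ℤ → Val n → Set
NearBoundary d θ y ρ = Any (λ u → ∃ λ j → j ℕ.< suc d × y ≡ evalL u ρ - + j) (boundaryPoints θ)

upperBound-step : ∀ y e d → + 0 < -[1+ 0 ] * y + e →
                  + 0 < -[1+ 0 ] * (y + + suc d) + e ⊎ ∃ λ j → j ℕ.< suc d × y ≡ e - + 1 - + j
upperBound-step y e d y<e with + 0 ℤ.<? (-[1+ 0 ] * (y + + suc d) + e)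
... | yes y+D<e = inj₁ y+D<e
... | no  y+D≮e = inj₂ (∣ w ∣ , w≤d , y≡)
  where
    w = e - + 1 - y
    w≡ : + ∣ w ∣ ≡ w
    w≡ = ℤ.0≤i⇒+∣i∣≡i (subst NonNeg (slack e y) (<⇒NonNeg y<e))
      where slack : ∀ e y → -[1+ 0 ] * y + e - + 0 - + 1 ≡ e - + 1 - y
            slack = solve-∀
    w≤d : ∣ w ∣ ℕ.< suc d
    w≤d = s≤s (ℤ.drop‿+≤+ (≤-from-slack _ (trans (slack e y (+ d)) (cong (λ z → + d - z) (sym w≡)))
                                           (≤⇒NonNeg (ℤ.≮⇒≥ y+D≮e))))
      where slack : ∀ e y d → + 0 - (-[1+ 0 ] * (y + (+ 1 + d)) + e) ≡ d - (e - + 1 - y)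
            slack = solve-∀
    y≡ : y ≡ e - + 1 - + ∣ w ∣
    y≡ = trans (lemma e y) (cong (_-_ (e - + 1)) (sym w≡))
      where lemma : ∀ e y → y ≡ e - + 1 - (e - + 1 - y)
            lemma = solve-∀

step-or-nearBoundary : ∀ d (θ : QF (suc n)) y ρ → ModuliDivide (+ suc d) θ → Normalised θ →
                       ⟦ θ ⟧q (y ∷ᵥ ρ) → ⟦ θ ⟧q ((y + + suc d) ∷ᵥ ρ) ⊎ NearBoundary d θ y ρ
step-or-nearBoundary d ⊤q y ρ _ _ p = inj₁ p
step-or-nearBoundary d (0< (+ k x+ t)) y ρ _ _ p =
  inj₁ (<-from-slack _ (lemma (+ k) y (+ suc d) (evalL t ρ))
                       (NonNeg-+ (<⇒NonNeg p) (NonNeg-* (NonNeg-ℕ k) (NonNeg-ℕ (suc d)))))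
  where lemma : ∀ c y D e → (c * y + e - + 0 - + 1) + c * D ≡ c * (y + D) + e - + 0 - + 1
        lemma = solve-∀
step-or-nearBoundary d (0< (-[1+ k ] x+ t)) y ρ _ (inj₂ ()) p
step-or-nearBoundary d (0< (-[1+ 0 ] x+ t)) y ρ _ (inj₁ refl) p
  with upperBound-step y (evalL t ρ) d p
... | inj₁ q = inj₁ q
... | inj₂ (j , j≤d , y≡) = inj₂ (here (j , j≤d , trans y≡ (cong (_- + j) (sym (evalL-minusConst t (+ 1) ρ)))))
step-or-nearBoundary d (dvd k (c x+ t)) y ρ k∣D _ p =
  inj₁ (subst (Divides k) (lemma c y (+ suc d) (evalL t ρ)) (∣m∣n⇒∣m+n p (∣n⇒∣m*n c k∣D)))
  where lemma : ∀ c y D e → c * y + e + c * D ≡ c * (y + D) + e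
        lemma = solve-∀
step-or-nearBoundary d (ndvd k (c x+ t)) y ρ k∣D _ p =
  inj₁ λ q → p (∣m+n∣n⇒∣m (subst (Divides k) (lemma c y (+ suc d) (evalL t ρ)) q) (∣n⇒∣m*n c k∣D))
  where lemma : ∀ c y D e → c * (y + D) + e ≡ c * y + e + c * D
        lemma = solve-∀
step-or-nearBoundary d (θ ∧q ψ) y ρ (θ∣ , ψ∣) (θn , ψn) (p , q)
  with step-or-nearBoundary d θ y ρ θ∣ θn p | step-or-nearBoundary d ψ y ρ ψ∣ ψn q
... | inj₁ p′ | inj₁ q′ = inj₁ (p′ , q′)
... | inj₂ h  | _       = inj₂ (++⁺ˡ h)
... | inj₁ _  | inj₂ h  = inj₂ (++⁺ʳ (boundaryPoints θ) h)
step-or-nearBoundary d (θ ∨q ψ) y ρ (θ∣ , ψ∣) (θn , ψn) (inj₁ p)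
  with step-or-nearBoundary d θ y ρ θ∣ θn p
... | inj₁ p′ = inj₁ (inj₁ p′)
... | inj₂ h  = inj₂ (++⁺ˡ h)
step-or-nearBoundary d (θ ∨q ψ) y ρ (θ∣ , ψ∣) (θn , ψn) (inj₂ q)
  with step-or-nearBoundary d ψ y ρ ψ∣ ψn q
... | inj₁ q′ = inj₁ (inj₂ q′)
... | inj₂ h  = inj₂ (++⁺ʳ (boundaryPoints θ) h)

atInfinity-periodic : ∀ (θ : QF (suc n)) D k y ρ → ModuliDivide D θ →
                      ⟦ atInfinity θ ⟧q (y ∷ᵥ ρ) → ⟦ atInfinity θ ⟧q ((y + k * D) ∷ᵥ ρ)
atInfinity-periodic ⊤q D k y ρ _ p = p
atInfinity-periodic (0< (+ zero x+ t)) D k y ρ _ p = subst (+ 0 <_) (lemma y (k * D) (evalL t ρ)) p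
  where lemma : ∀ y w e → + 0 * y + e ≡ + 0 * (y + w) + e
        lemma = solve-∀
atInfinity-periodic (0< (+ suc _ x+ t)) D k y ρ _ p = p
atInfinity-periodic (dvd j (c x+ t)) D k y ρ j∣D p =
  subst (Divides j) (lemma c y k D (evalL t ρ)) (∣m∣n⇒∣m+n p (∣n⇒∣m*n (c * k) j∣D))
  where lemma : ∀ c y k D e → c * y + e + c * k * D ≡ c * (y + k * D) + e
        lemma = solve-∀
atInfinity-periodic (ndvd j (c x+ t)) D k y ρ j∣D p =
  λ q → p (∣m+n∣n⇒∣m (subst (Divides j) (lemma c y k D (evalL t ρ)) q) (∣n⇒∣m*n (c * k) j∣D))
  where lemma : ∀ c y k D e → c * (y + k * D) + e ≡ c * y + e + c * k * D
        lemma = solve-∀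
atInfinity-periodic (θ ∧q ψ) D k y ρ (θ∣ , ψ∣) (p , q) =
  atInfinity-periodic θ D k y ρ θ∣ p , atInfinity-periodic ψ D k y ρ ψ∣ q
atInfinity-periodic (θ ∨q ψ) D k y ρ (θ∣ , _) (inj₁ p) = inj₁ (atInfinity-periodic θ D k y ρ θ∣ p)
atInfinity-periodic (θ ∨q ψ) D k y ρ (_ , ψ∣) (inj₂ q) = inj₂ (atInfinity-periodic ψ D k y ρ ψ∣ q)

private
  beyond⇒NonNeg : ∀ {e y} → + ∣ e ∣ < y → NonNeg y
  beyond⇒NonNeg {e} {y} e<y =
    subst NonNeg (lemma y (+ ∣ e ∣)) (NonNeg-+ (NonNeg-+ (<⇒NonNeg e<y) (NonNeg-ℕ ∣ e ∣)) (NonNeg-ℕ 1))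
    where lemma : ∀ y a → y - a - + 1 + a + + 1 ≡ y
          lemma = solve-∀

0<-beyond-∣∣ : ∀ k e y → + ∣ e ∣ < y → + 0 < + suc k * y + e
0<-beyond-∣∣ k e y e<y =
  <-from-slack _ (lemma (+ k) y e (+ ∣ e ∣))
    (NonNeg-+ (NonNeg-+ (NonNeg-* (NonNeg-ℕ k) (beyond⇒NonNeg {e} e<y)) (<⇒NonNeg e<y)) (NonNeg-∣∣+ e))
  where lemma : ∀ k y e a → k * y + (y - a - + 1) + (a + e) ≡ (+ 1 + k) * y + e - + 0 - + 1
        lemma = solve-∀

≮0-beyond-∣∣ : ∀ k e y → + ∣ e ∣ < y → ¬ + 0 < -[1+ k ] * y + e
≮0-beyond-∣∣ k e y e<y 0<ky+e =
  NonNeg-+-≢-[1+]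
    (NonNeg-+ (NonNeg-+ (<⇒NonNeg 0<ky+e) (NonNeg-* (NonNeg-ℕ k) (beyond⇒NonNeg {e} e<y))) (<⇒NonNeg e<y))
    (NonNeg-∣∣- e) (lemma (+ k) y e (+ ∣ e ∣))
  where lemma : ∀ k y e a → (- (+ 1 + k) * y + e - + 0 - + 1) + k * y + (y - a - + 1) + (a - e) ≡ -[1+ 1 ]
        lemma = solve-∀

atInfinity-agrees : ∀ (θ : QF (suc n)) y ρ → + threshold θ ρ < y →
                    ⟦ θ ⟧q (y ∷ᵥ ρ) ⇔ ⟦ atInfinity θ ⟧q (y ∷ᵥ ρ)
atInfinity-agrees ⊤q                   y ρ _ = ⇔-id _
atInfinity-agrees ⊥q                   y ρ _ = ⇔-id _
atInfinity-agrees (0< (+ zero x+ t))   y ρ _ = ⇔-id _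
atInfinity-agrees (0< (+ suc k x+ t))  y ρ t<y = mk⇔ (λ _ → tt) (λ _ → 0<-beyond-∣∣ k (evalL t ρ) y t<y)
atInfinity-agrees (0< (-[1+ k ] x+ t)) y ρ t<y = mk⇔ (≮0-beyond-∣∣ k (evalL t ρ) y t<y) λ ()
atInfinity-agrees (dvd k s)            y ρ _ = ⇔-id _
atInfinity-agrees (ndvd k s)           y ρ _ = ⇔-id _
atInfinity-agrees (θ ∧q ψ) y ρ θψ<y =
  atInfinity-agrees θ y ρ (+-<ˡ θψ<y) ×-⇔ atInfinity-agrees ψ y ρ (+-<ʳ θψ<y)
  where
    +-<ˡ = ℤ.≤-<-trans (+≤+ (ℕ.m≤m+n (threshold θ ρ) (threshold ψ ρ)))
    +-<ʳ = ℤ.≤-<-trans (+≤+ (ℕ.m≤n+m (threshold ψ ρ) (threshold θ ρ)))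
atInfinity-agrees (θ ∨q ψ) y ρ θψ<y =
  atInfinity-agrees θ y ρ (+-<ˡ θψ<y) ⊎-⇔ atInfinity-agrees ψ y ρ (+-<ʳ θψ<y)
  where
    +-<ˡ = ℤ.≤-<-trans (+≤+ (ℕ.m≤m+n (threshold θ ρ) (threshold ψ ρ)))
    +-<ʳ = ℤ.≤-<-trans (+≤+ (ℕ.m≤n+m (threshold ψ ρ) (threshold θ ρ)))

[const]-correct : ∀ (θ : QF (suc n)) j ρ → ⟦ θ [ constL j ] ⟧q ρ ⇔ ⟦ θ ⟧q (j ∷ᵥ ρ)
[const]-correct θ j ρ = cong-⇔ (λ z → ⟦ θ ⟧q (z ∷ᵥ ρ)) (evalL-const j ρ) ⇔-∘ []-correct θ (constL j) ρ

[minusConst]-correct : ∀ (θ : QF (suc n)) u j ρ →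
                       ⟦ θ [ u -L constL j ] ⟧q ρ ⇔ ⟦ θ ⟧q ((evalL u ρ - j) ∷ᵥ ρ)
[minusConst]-correct θ u j ρ =
  cong-⇔ (λ z → ⟦ θ ⟧q (z ∷ᵥ ρ)) (evalL-minusConst u j ρ) ⇔-∘ []-correct θ (u -L constL j) ρ

beyond-threshold : ∀ B y d → + B < y + + (B ℕ.+ ∣ y ∣ ℕ.+ 1) * + suc d
beyond-threshold B y d =
  <-from-slack ((+ ∣ y ∣ + y) + (+ B + + ∣ y ∣ + + 1) * + d) (lemma (+ B) y (+ ∣ y ∣) (+ d))
    (NonNeg-+ (NonNeg-∣∣+ y) (NonNeg-* (NonNeg-ℕ (B ℕ.+ ∣ y ∣ ℕ.+ 1)) (NonNeg-ℕ d)))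
  where
    lemma : ∀ B y a d → (a + y) + (B + a + + 1) * d ≡ y + (B + a + + 1) * (+ 1 + d) - B - + 1
    lemma = solve-∀

cooper : QF (suc n) → ℕ → QF n
cooper θ d = ⋁< (suc d) (λ j → atInfinity θ [ constL (+ j) ])
          ∨q ⋁∈ (boundaryPoints θ) (λ u → ⋁< (suc d) (λ j → θ [ u -L constL (+ j) ]))

module _ (θ : QF (suc n)) (d : ℕ) (ρ : Val n) (θ∣D : ModuliDivide (+ suc d) θ) (θn : Normalised θ) where
  private
    D = + suc d
    Sat : ℤ → Set
    Sat y = ⟦ θ ⟧q (y ∷ᵥ ρ)
    SatAtInfinity : ℤ → Set
    SatAtInfinity y = ⟦ atInfinity θ ⟧q (y ∷ᵥ ρ)
    NearSat : Set
    NearSat = Any (λ u → ∃ λ j → j ℕ.< suc d × Sat (evalL u ρ - + j)) (boundaryPoints θ)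

    steps-or-nearBoundary : ∀ K y → Sat y → Sat (y + + K * D) ⊎ NearSat
    steps-or-nearBoundary zero y p = inj₁ (subst Sat (lemma y D) p)
      where lemma : ∀ y D → y ≡ y + + 0 * D
            lemma = solve-∀
    steps-or-nearBoundary (suc K) y p with steps-or-nearBoundary K y p
    ... | inj₂ h = inj₂ h
    ... | inj₁ q with step-or-nearBoundary d θ (y + + K * D) ρ θ∣D θn q
    ...   | inj₁ r = inj₁ (subst Sat (lemma y (+ K) D) r)
      where lemma : ∀ y K D → y + K * D + D ≡ y + (+ 1 + K) * D
            lemma = solve-∀
    ...   | inj₂ h = inj₂ (Any.map (λ (j , j≤d , y≡) → j , j≤d , subst Sat y≡ q) h)

    reduce-mod : ∀ z → SatAtInfinity z → ∃ λ j → j ℕ.< suc d × SatAtInfinity (+ j)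
    reduce-mod z p = j , n%ℕd<d z (suc d) , subst SatAtInfinity z-qD≡j p′
      where
        j = z %ℕ suc d
        q = z /ℕ suc d
        p′ = atInfinity-periodic θ D (- q) z ρ θ∣D p
        z-qD≡j : z + (- q) * D ≡ + j
        z-qD≡j = trans (cong (λ w → w + (- q) * D) (a≡a%ℕn+[a/ℕn]*n z (suc d))) (lemma (+ j) q D)
          where lemma : ∀ j q D → j + q * D + (- q) * D ≡ j
                lemma = solve-∀

    -- Climbing by D from a solution either reaches the region beyond the threshold, where
    -- θ agrees with its D-periodic form at infinity, or is stopped near a boundary point.
    exists⇒candidate : ∃ Sat → (∃ λ j → j ℕ.< suc d × SatAtInfinity (+ j)) ⊎ NearSat
    exists⇒candidate (y , p) with steps-or-nearBoundary K y p
      where K = threshold θ ρ ℕ.+ ∣ y ∣ ℕ.+ 1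
    ... | inj₂ h = inj₂ h
    ... | inj₁ q = inj₁ (reduce-mod _ (to (atInfinity-agrees θ _ ρ (beyond-threshold (threshold θ ρ) y d)) q))

    atInfinity⇒exists : ∀ j → SatAtInfinity (+ j) → ∃ Sat
    atInfinity⇒exists j p = _ , from (atInfinity-agrees θ _ ρ (beyond-threshold (threshold θ ρ) (+ j) d))
                                     (atInfinity-periodic θ D (+ K) (+ j) ρ θ∣D p)
      where K = threshold θ ρ ℕ.+ j ℕ.+ 1

  cooper-correct : (∃ Sat) ⇔ ⟦ cooper θ d ⟧q ρ
  cooper-correct = mk⇔ to′ from′
    where
      atInfinity⇔ : ∀ j → ⟦ atInfinity θ [ constL (+ j) ] ⟧q ρ ⇔ SatAtInfinity (+ j)
      atInfinity⇔ j = [const]-correct (atInfinity θ) (+ j) ρ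
      nearSat⇔ : ⟦ ⋁∈ (boundaryPoints θ) (λ u → ⋁< (suc d) (λ j → θ [ u -L constL (+ j) ])) ⟧q ρ ⇔ NearSat
      nearSat⇔ = mk⇔
        (Any.map (λ {u} h → let (j , j≤d , p) = to (⋁<-correct (suc d) _ ρ) h
                             in j , j≤d , to ([minusConst]-correct θ u (+ j) ρ) p)
         ∘ to (⋁∈-correct (boundaryPoints θ) _ ρ))
        (from (⋁∈-correct (boundaryPoints θ) _ ρ)
         ∘ Any.map (λ {u} (j , j≤d , p) → from (⋁<-correct (suc d) _ ρ)
                                            (j , j≤d , from ([minusConst]-correct θ u (+ j) ρ) p)))
      to′ : ∃ Sat → ⟦ cooper θ d ⟧q ρ
      to′ s with exists⇒candidate s
      ... | inj₁ (j , j≤d , p) = inj₁ (from (⋁<-correct (suc d) _ ρ) (j , j≤d , from (atInfinity⇔ j) p))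
      ... | inj₂ h = inj₂ (from nearSat⇔ h)
      from′ : ⟦ cooper θ d ⟧q ρ → ∃ Sat
      from′ (inj₁ c) = let (j , _ , p) = to (⋁<-correct (suc d) _ ρ) c in atInfinity⇒exists j (to (atInfinity⇔ j) p)
      from′ (inj₂ c) = let (u , j , _ , p) = Any.satisfied (to nearSat⇔ c) in _ , p

unitForm-normalised : ∀ (θ : QF (suc n)) → Normalised (unitForm θ)
unitForm-normalised θ = tt , normalise-normalised θ 0

eliminate : QF (suc n) → QF n
eliminate θ = cooper (unitForm θ) (modulus (unitForm θ))

eliminate-correct : ∀ (θ : QF (suc n)) ρ → (∃ λ x → ⟦ θ ⟧q (x ∷ᵥ ρ)) ⇔ ⟦ eliminate θ ⟧q ρ
eliminate-correct θ ρ = cooper-correct θ′ (modulus θ′) ρ (moduliDivide-modulus θ′) (unitForm-normalised θ) ⇔-∘ mk⇔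
  (λ (x , p) → _ , from (unitForm-correct θ _ ρ) (x , refl , p))
  (λ (y , q) → let (x , _ , p) = to (unitForm-correct θ y ρ) q in x , p)
  where θ′ = unitForm θ

-- Quantifier elimination

data LinFormula (n : ℕ) : Set where
  atom            : QF n → LinFormula n
  ¬ℓ_             : LinFormula n → LinFormula n
  _∧ℓ_ _∨ℓ_ _⇒ℓ_ : LinFormula n → LinFormula n → LinFormula n
  ∃ℓ ∀ℓ           : LinFormula (suc n) → LinFormula n

infixr 6 _∧ℓ_
infixr 5 _∨ℓ_
infixr 4 _⇒ℓ_

⟦_⟧ℓ : LinFormula n → Val n → Set
⟦ atom θ ⟧ℓ  ρ = ⟦ θ ⟧q ρ
⟦ ¬ℓ φ ⟧ℓ    ρ = ¬ ⟦ φ ⟧ℓ ρ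
⟦ φ ∧ℓ ψ ⟧ℓ  ρ = ⟦ φ ⟧ℓ ρ × ⟦ ψ ⟧ℓ ρ
⟦ φ ∨ℓ ψ ⟧ℓ  ρ = ⟦ φ ⟧ℓ ρ ⊎ ⟦ ψ ⟧ℓ ρ
⟦ φ ⇒ℓ ψ ⟧ℓ  ρ = ⟦ φ ⟧ℓ ρ → ⟦ ψ ⟧ℓ ρ
⟦ ∃ℓ φ ⟧ℓ    ρ = ∃ λ a → ⟦ φ ⟧ℓ (a ∷ᵥ ρ)
⟦ ∀ℓ φ ⟧ℓ    ρ = ∀ a → ⟦ φ ⟧ℓ (a ∷ᵥ ρ)

qe : LinFormula n → QF n
qe (atom θ) = θ
qe (¬ℓ φ)   = negateQ (qe φ)
qe (φ ∧ℓ ψ) = qe φ ∧q qe ψ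
qe (φ ∨ℓ ψ) = qe φ ∨q qe ψ
qe (φ ⇒ℓ ψ) = negateQ (qe φ) ∨q qe ψ
qe (∃ℓ φ)   = eliminate (qe φ)
qe (∀ℓ φ)   = negateQ (eliminate (negateQ (qe φ)))

qe-correct : ∀ (φ : LinFormula n) ρ → ⟦ φ ⟧ℓ ρ ⇔ ⟦ qe φ ⟧q ρ
qe-correct (atom θ) ρ = ⇔-id _
qe-correct (¬ℓ φ)   ρ = ⇔-sym (negateQ-correct (qe φ) ρ) ⇔-∘ ¬-cong-⇔ (qe-correct φ ρ)
qe-correct (φ ∧ℓ ψ) ρ = qe-correct φ ρ ×-⇔ qe-correct ψ ρ
qe-correct (φ ∨ℓ ψ) ρ = qe-correct φ ρ ⊎-⇔ qe-correct ψ ρ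
qe-correct (φ ⇒ℓ ψ) ρ = begin
  (⟦ φ ⟧ℓ ρ → ⟦ ψ ⟧ℓ ρ)                ∼⟨ →-cong-⇔ (qe-correct φ ρ) (qe-correct ψ ρ) ⟩
  (⟦ qe φ ⟧q ρ → ⟦ qe ψ ⟧q ρ)          ∼⟨ →⇔¬⊎ (⟦ qe φ ⟧q? ρ) ⟩
  ((¬ ⟦ qe φ ⟧q ρ) ⊎ ⟦ qe ψ ⟧q ρ)      ∼⟨ ⇔-sym (negateQ-correct (qe φ) ρ) ⊎-⇔ ⇔-id _ ⟩
  ⟦ negateQ (qe φ) ∨q qe ψ ⟧q ρ        ∎
  where open EquationalReasoning
qe-correct (∃ℓ φ)   ρ = eliminate-correct (qe φ) ρ ⇔-∘ ∃-cong-⇔ (λ a → qe-correct φ (a ∷ᵥ ρ))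
qe-correct (∀ℓ φ)   ρ = begin
  (∀ a → ⟦ φ ⟧ℓ (a ∷ᵥ ρ))               ∼⟨ Π-cong-⇔ (λ a → qe-correct φ (a ∷ᵥ ρ)) ⟩
  (∀ a → ⟦ qe φ ⟧q (a ∷ᵥ ρ))            ∼⟨ ∀⇔¬∃¬ (λ a → ⟦ qe φ ⟧q? (a ∷ᵥ ρ)) ⟩
  (¬ ∃ λ a → ¬ ⟦ qe φ ⟧q (a ∷ᵥ ρ))
    ∼⟨ ¬-cong-⇔ (∃-cong-⇔ (λ a → ⇔-sym (negateQ-correct (qe φ) (a ∷ᵥ ρ)))) ⟩
  (¬ ∃ λ a → ⟦ ¬φ ⟧q (a ∷ᵥ ρ))          ∼⟨ ¬-cong-⇔ (eliminate-correct ¬φ ρ) ⟩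
  (¬ ⟦ eliminate ¬φ ⟧q ρ)               ∼⟨ ⇔-sym (negateQ-correct (eliminate ¬φ) ρ) ⟩
  ⟦ negateQ (eliminate ¬φ) ⟧q ρ         ∎
  where
    open EquationalReasoning
    ¬φ = negateQ (qe φ)

⟦⟧ℓ-cong : ∀ (φ : LinFormula n) {ρ ρ′} → (∀ i → ρ i ≡ ρ′ i) → ⟦ φ ⟧ℓ ρ ⇔ ⟦ φ ⟧ℓ ρ′
⟦⟧ℓ-cong φ {ρ} {ρ′} ρ≗ρ′ = ⇔-sym (qe-correct φ ρ′) ⇔-∘ (⟦⟧q-cong (qe φ) ρ≗ρ′ ⇔-∘ qe-correct φ ρ)

infix 4 _<q_ _≤q_ _≡q_ _≢q_

_<q_ _≤q_ _≡q_ _≢q_ : Lin n → Lin n → QF n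
s <q t = 0< (t -L s)
s ≤q t = 0< (t -L s +L constL (+ 1))
s ≡q t = s ≤q t ∧q t ≤q s
s ≢q t = s <q t ∨q t <q s

<q-correct : ∀ (s t : Lin n) ρ → ⟦ s <q t ⟧q ρ ⇔ evalL s ρ < evalL t ρ
<q-correct s t ρ = mk⇔
  (λ 0<t-s → <-from-slack _ (slack a b) (<⇒NonNeg (subst (+ 0 <_) (evalL-- t s ρ) 0<t-s)))
  (λ s<t → subst (+ 0 <_) (sym (evalL-- t s ρ)) (<-from-slack _ (sym (slack a b)) (<⇒NonNeg s<t)))
  where
    a = evalL s ρ
    b = evalL t ρ
    slack : ∀ a b → b - a - + 0 - + 1 ≡ b - a - + 1
    slack = solve-∀

≤q-correct : ∀ (s t : Lin n) ρ → ⟦ s ≤q t ⟧q ρ ⇔ evalL s ρ ≤ evalL t ρ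
≤q-correct s t ρ = mk⇔
  (λ 0<t-s+1 → ≤-from-slack _ (slack a b) (<⇒NonNeg (subst (+ 0 <_) t-s+1≡ 0<t-s+1)))
  (λ s≤t → subst (+ 0 <_) (sym t-s+1≡) (<-from-slack _ (sym (slack a b)) (≤⇒NonNeg s≤t)))
  where
    a = evalL s ρ
    b = evalL t ρ
    t-s+1≡ : evalL (t -L s +L constL (+ 1)) ρ ≡ b - a + + 1
    t-s+1≡ = trans (evalL-+ (t -L s) _ ρ) (cong₂ _+_ (evalL-- t s ρ) (evalL-const (+ 1) ρ))
    slack : ∀ a b → b - a + + 1 - + 0 - + 1 ≡ b - a
    slack = solve-∀

≡q-correct : ∀ (s t : Lin n) ρ → ⟦ s ≡q t ⟧q ρ ⇔ evalL s ρ ≡ evalL t ρ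
≡q-correct s t ρ = mk⇔
  (λ (s≤t , t≤s) → ℤ.≤-antisym (to (≤q-correct s t ρ) s≤t) (to (≤q-correct t s ρ) t≤s))
  (λ s≡t → from (≤q-correct s t ρ) (ℤ.≤-reflexive s≡t) , from (≤q-correct t s ρ) (ℤ.≤-reflexive (sym s≡t)))

≢q-correct : ∀ (s t : Lin n) ρ → ⟦ s ≢q t ⟧q ρ ⇔ evalL s ρ ≢ evalL t ρ
≢q-correct s t ρ = mk⇔
  (λ { (inj₁ s<t) → ℤ.<⇒≢ (to (<q-correct s t ρ) s<t) ; (inj₂ t<s) → ℤ.<⇒≢ (to (<q-correct t s ρ) t<s) ∘ sym })
  (λ s≢t → by-trichotomy s≢t (ℤ.<-cmp (evalL s ρ) (evalL t ρ)))
  where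
    a = evalL s ρ
    b = evalL t ρ
    by-trichotomy : a ≢ b → Tri (a < b) (a ≡ b) (b < a) → ⟦ s ≢q t ⟧q ρ
    by-trichotomy s≢t (tri< s<t _ _) = inj₁ (from (<q-correct s t ρ) s<t)
    by-trichotomy s≢t (tri≈ _ s≡t _) = ⊥-elim (s≢t s≡t)
    by-trichotomy s≢t (tri> _ _ t<s) = inj₂ (from (<q-correct t s ρ) t<s)

termL : Term n → Lin n
termL (var i) = varL i
termL (s ⊕ t) = termL s +L termL t

termL-correct : ∀ (s : Term n) ρ → evalL (termL s) ρ ≡ evalT s ρ
termL-correct (var i) ρ = evalL-var i ρ
termL-correct (s ⊕ t) ρ = trans (evalL-+ (termL s) (termL t) ρ) (cong₂ _+_ (termL-correct s ρ) (termL-correct t ρ))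

fromFormula : Formula n → LinFormula n
fromFormula (s ≐ t)  = atom (termL s ≡q termL t)
fromFormula (s ≺ t)  = atom (termL s <q termL t)
fromFormula ⊤f       = atom ⊤q
fromFormula ⊥f       = atom ⊥q
fromFormula (¬f φ)   = ¬ℓ fromFormula φ
fromFormula (φ ∧f ψ) = fromFormula φ ∧ℓ fromFormula ψ
fromFormula (φ ∨f ψ) = fromFormula φ ∨ℓ fromFormula ψ
fromFormula (φ ⇒f ψ) = fromFormula φ ⇒ℓ fromFormula ψ
fromFormula (∃f φ)   = ∃ℓ (fromFormula φ)
fromFormula (∀f φ)   = ∀ℓ (fromFormula φ)

fromFormula-correct : ∀ (φ : Formula n) ρ → ⟦ fromFormula φ ⟧ℓ ρ ⇔ ⟦ φ ⟧ ρ
fromFormula-correct (s ≐ t) ρ rewrite sym (termL-correct s ρ) | sym (termL-correct t ρ) = ≡q-correct (termL s) (termL t) ρ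
fromFormula-correct (s ≺ t) ρ rewrite sym (termL-correct s ρ) | sym (termL-correct t ρ) = <q-correct (termL s) (termL t) ρ
fromFormula-correct ⊤f       ρ = ⇔-id _
fromFormula-correct ⊥f       ρ = ⇔-id _
fromFormula-correct (¬f φ)   ρ = ¬-cong-⇔ (fromFormula-correct φ ρ)
fromFormula-correct (φ ∧f ψ) ρ = fromFormula-correct φ ρ ×-⇔ fromFormula-correct ψ ρ
fromFormula-correct (φ ∨f ψ) ρ = fromFormula-correct φ ρ ⊎-⇔ fromFormula-correct ψ ρ
fromFormula-correct (φ ⇒f ψ) ρ = →-cong-⇔ (fromFormula-correct φ ρ) (fromFormula-correct ψ ρ)
fromFormula-correct (∃f φ)   ρ = ∃-cong-⇔ (λ a → fromFormula-correct φ (a ∷ᵥ ρ))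
fromFormula-correct (∀f φ)   ρ = Π-cong-⇔ (λ a → fromFormula-correct φ (a ∷ᵥ ρ))

-- Translation back into the language ⟨<,+⟩

-- There are no constants, so terms carry a variable o whose value is 1 and an
-- accumulator (there is no empty sum); negative coefficients are moved to the other side.
addTimes : ℕ → Term k → Term k → Term k
addTimes zero    v acc = acc
addTimes (suc m) v acc = addTimes m v (acc ⊕ v)

addTimes-correct : ∀ m (v acc : Term k) σ → evalT (addTimes m v acc) σ ≡ evalT acc σ + + m * evalT v σ
addTimes-correct zero v acc σ =
  sym (trans (cong (_+_ (evalT acc σ)) (ℤ.*-zeroˡ (evalT v σ))) (ℤ.+-identityʳ _))
addTimes-correct (suc m) v acc σ =
  trans (addTimes-correct m v (acc ⊕ v) σ) (lemma (evalT acc σ) (+ m) (evalT v σ))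
  where lemma : ∀ a m v → a + v + m * v ≡ a + (+ 1 + m) * v
        lemma = solve-∀

positivePart negativePart : ℤ → ℕ
positivePart (+ m)    = m
positivePart -[1+ m ] = 0
negativePart (+ m)    = 0
negativePart -[1+ m ] = suc m

positive-negative : ∀ c → c ≡ + positivePart c - + negativePart c
positive-negative (+ m)    = sym (ℤ.+-identityʳ (+ m))
positive-negative -[1+ m ] = refl

mapL : (ℤ → ℤ) → Lin n → Lin n
mapL g (cst c)  = cst (g c)
mapL g (c x+ t) = g c x+ mapL g t

evalL-split : ∀ (t : Lin n) ρ →
  evalL t ρ ≡ evalL (mapL (+_ ∘ positivePart) t) ρ - evalL (mapL (+_ ∘ negativePart) t) ρ
evalL-split (cst c)  ρ = positive-negative c
evalL-split (c x+ t) ρ =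
  trans (cong₂ (λ a b → a * ρ zero + b) (positive-negative c) (evalL-split t (tail ρ)))
        (lemma (+ positivePart c) (+ negativePart c) (ρ zero) _ _)
  where lemma : ∀ p q x P N → (p - q) * x + (P - N) ≡ p * x + P - (q * x + N)
        lemma = solve-∀

sumTerm : (ℤ → ℕ) → Lin n → (Fin n → Fin k) → Fin k → Term k → Term k
sumTerm κ (cst c)  f o acc = addTimes (κ c) (var o) acc
sumTerm κ (c x+ t) f o acc = sumTerm κ t (f ∘ suc) o (addTimes (κ c) (var (f zero)) acc)

sumTerm-correct : ∀ κ (t : Lin n) (f : Fin n → Fin k) o σ → σ o ≡ + 1 → ∀ acc →
                  evalT (sumTerm κ t f o acc) σ ≡ evalT acc σ + evalL (mapL (+_ ∘ κ) t) (σ ∘ f)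
sumTerm-correct κ (cst c) f o σ σo≡1 acc =
  trans (addTimes-correct (κ c) (var o) acc σ)
        (trans (cong (λ z → evalT acc σ + + κ c * z) σo≡1) (cong (_+_ (evalT acc σ)) (ℤ.*-identityʳ (+ κ c))))
sumTerm-correct κ (c x+ t) f o σ σo≡1 acc =
  trans (sumTerm-correct κ t (f ∘ suc) o σ σo≡1 _)
        (trans (cong (_+ evalL (mapL (+_ ∘ κ) t) (σ ∘ f ∘ suc)) (addTimes-correct (κ c) (var (f zero)) acc σ))
               (ℤ.+-assoc (evalT acc σ) _ _))

posTerm negTerm : Lin n → (Fin n → Fin k) → Fin k → Term k
posTerm t f o = sumTerm positivePart t f o (var o)
negTerm t f o = sumTerm negativePart t f o (var o)

posTerm-correct : ∀ (t : Lin n) (f : Fin n → Fin k) o σ → σ o ≡ + 1 →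
  evalT (posTerm t f o) σ ≡ evalL t (σ ∘ f) + evalT (negTerm t f o) σ
posTerm-correct t f o σ σo≡1 = begin
  evalT (posTerm t f o) σ      ≡⟨ sumTerm-correct positivePart t f o σ σo≡1 (var o) ⟩
  σ o + P                      ≡⟨ lemma (σ o) P N ⟩
  (P - N) + (σ o + N)          ≡⟨ cong₂ _+_ (sym (evalL-split t (σ ∘ f)))
                                            (sym (sumTerm-correct negativePart t f o σ σo≡1 (var o))) ⟩
  evalL t (σ ∘ f) + evalT (negTerm t f o) σ ∎
  where
    open ≡-Reasoning
    P = evalL (mapL (+_ ∘ positivePart) t) (σ ∘ f)
    N = evalL (mapL (+_ ∘ negativePart) t) (σ ∘ f)
    lemma : ∀ o P N → o + P ≡ (P - N) + (o + N)
    lemma = solve-∀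

divisibleFormula : ℕ → Lin n → (Fin n → Fin k) → Fin k → Formula k
divisibleFormula d t f o =
  ∃f (addTimes (suc d) (var zero) (negTerm t (suc ∘ f) (suc o))
      ≐ posTerm t (suc ∘ f) (suc o))

divisibleFormula-correct : ∀ d (t : Lin n) (f : Fin n → Fin k) o σ → σ o ≡ + 1 →
                           ⟦ divisibleFormula d t f o ⟧ σ ⇔ Divides d (evalL t (σ ∘ f))
divisibleFormula-correct d t f o σ σo≡1 = mk⇔
  (λ (q , eq) → divides q (∙-cancelʳ (Nq q) _ _ (trans (sym (P≡ q)) (trans (sym eq) (lhs≡ q)))))
  (λ (divides q eq) → q , trans (lhs≡ q) (trans (cong (_+ Nq q) (sym eq)) (sym (P≡ q))))
  where
    E = evalL t (σ ∘ f)
    Nq Pq : ℤ → ℤ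
    Nq q = evalT (negTerm t (suc ∘ f) (suc o)) (q ∷ᵥ σ)
    Pq q = evalT (posTerm t (suc ∘ f) (suc o)) (q ∷ᵥ σ)
    P≡ : ∀ q → Pq q ≡ E + Nq q
    P≡ q = posTerm-correct t (suc ∘ f) (suc o) (q ∷ᵥ σ) σo≡1
    lhs≡ : ∀ q → evalT (addTimes (suc d) (var zero) (negTerm t (suc ∘ f) (suc o))) (q ∷ᵥ σ) ≡ q * + suc d + Nq q
    lhs≡ q = trans (addTimes-correct (suc d) (var zero) _ (q ∷ᵥ σ)) (lemma (Nq q) q (+ suc d))
      where lemma : ∀ n q d → n + d * q ≡ q * d + n
            lemma = solve-∀

toFormulaQ : QF n → (Fin n → Fin k) → Fin k → Formula k
toFormulaQ ⊤q         f o = ⊤f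
toFormulaQ ⊥q         f o = ⊥f
toFormulaQ (0< t)     f o = negTerm t f o ≺ posTerm t f o
toFormulaQ (dvd d t)  f o = divisibleFormula d t f o
toFormulaQ (ndvd d t) f o = ¬f (divisibleFormula d t f o)
toFormulaQ (θ ∧q ψ)   f o = toFormulaQ θ f o ∧f toFormulaQ ψ f o
toFormulaQ (θ ∨q ψ)   f o = toFormulaQ θ f o ∨f toFormulaQ ψ f o

toFormulaQ-correct : ∀ (θ : QF n) (f : Fin n → Fin k) o σ → σ o ≡ + 1 →
                     ⟦ toFormulaQ θ f o ⟧ σ ⇔ ⟦ θ ⟧q (σ ∘ f)
toFormulaQ-correct ⊤q f o σ σo≡1 = ⇔-id _
toFormulaQ-correct ⊥q f o σ σo≡1 = ⇔-id _
toFormulaQ-correct (0< t) f o σ σo≡1 rewrite posTerm-correct t f o σ σo≡1 = mk⇔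
  (λ N<E+N → <-from-slack _ (slack E N) (<⇒NonNeg N<E+N))
  (λ 0<E → <-from-slack _ (sym (slack E N)) (<⇒NonNeg 0<E))
  where
    E = evalL t (σ ∘ f)
    N = evalT (negTerm t f o) σ
    slack : ∀ E N → E + N - N - + 1 ≡ E - + 0 - + 1
    slack = solve-∀
toFormulaQ-correct (dvd d t)  f o σ σo≡1 = divisibleFormula-correct d t f o σ σo≡1
toFormulaQ-correct (ndvd d t) f o σ σo≡1 = ¬-cong-⇔ (divisibleFormula-correct d t f o σ σo≡1)
toFormulaQ-correct (θ ∧q ψ)   f o σ σo≡1 = toFormulaQ-correct θ f o σ σo≡1 ×-⇔ toFormulaQ-correct ψ f o σ σo≡1
toFormulaQ-correct (θ ∨q ψ)   f o σ σo≡1 = toFormulaQ-correct θ f o σ σo≡1 ⊎-⇔ toFormulaQ-correct ψ f o σ σo≡1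

liftRenaming : (Fin n → Fin k) → Fin (suc n) → Fin (suc k)
liftRenaming f zero    = zero
liftRenaming f (suc i) = suc (f i)

toFormula : LinFormula n → (Fin n → Fin k) → Fin k → Formula k
toFormula (atom θ) f o = toFormulaQ θ f o
toFormula (¬ℓ φ)   f o = ¬f toFormula φ f o
toFormula (φ ∧ℓ ψ) f o = toFormula φ f o ∧f toFormula ψ f o
toFormula (φ ∨ℓ ψ) f o = toFormula φ f o ∨f toFormula ψ f o
toFormula (φ ⇒ℓ ψ) f o = toFormula φ f o ⇒f toFormula ψ f o
toFormula (∃ℓ φ)   f o = ∃f (toFormula φ (liftRenaming f) (suc o))
toFormula (∀ℓ φ)   f o = ∀f (toFormula φ (liftRenaming f) (suc o))

toFormula-correct : ∀ (φ : LinFormula n) (f : Fin n → Fin k) o σ → σ o ≡ + 1 →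
                    ⟦ toFormula φ f o ⟧ σ ⇔ ⟦ φ ⟧ℓ (σ ∘ f)
toFormula-correct (atom θ) f o σ σo≡1 = toFormulaQ-correct θ f o σ σo≡1
toFormula-correct (¬ℓ φ)   f o σ σo≡1 = ¬-cong-⇔ (toFormula-correct φ f o σ σo≡1)
toFormula-correct (φ ∧ℓ ψ) f o σ σo≡1 = toFormula-correct φ f o σ σo≡1 ×-⇔ toFormula-correct ψ f o σ σo≡1
toFormula-correct (φ ∨ℓ ψ) f o σ σo≡1 = toFormula-correct φ f o σ σo≡1 ⊎-⇔ toFormula-correct ψ f o σ σo≡1
toFormula-correct (φ ⇒ℓ ψ) f o σ σo≡1 =
  →-cong-⇔ (toFormula-correct φ f o σ σo≡1) (toFormula-correct ψ f o σ σo≡1)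
toFormula-correct (∃ℓ φ)   f o σ σo≡1 = ∃-cong-⇔ λ a →
  ⟦⟧ℓ-cong φ (lift-∷ᵥ a) ⇔-∘ toFormula-correct φ (liftRenaming f) (suc o) (a ∷ᵥ σ) σo≡1
  where lift-∷ᵥ : ∀ a i → (a ∷ᵥ σ) (liftRenaming f i) ≡ (a ∷ᵥ (σ ∘ f)) i
        lift-∷ᵥ a zero    = refl
        lift-∷ᵥ a (suc i) = refl
toFormula-correct (∀ℓ φ)   f o σ σo≡1 = Π-cong-⇔ λ a →
  ⟦⟧ℓ-cong φ (lift-∷ᵥ a) ⇔-∘ toFormula-correct φ (liftRenaming f) (suc o) (a ∷ᵥ σ) σo≡1
  where lift-∷ᵥ : ∀ a i → (a ∷ᵥ σ) (liftRenaming f i) ≡ (a ∷ᵥ (σ ∘ f)) i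
        lift-∷ᵥ a zero    = refl
        lift-∷ᵥ a (suc i) = refl

-- x_o = 1: some z with z + z = z (so z = 0) lies below x_o with nothing strictly in between.
IsOne : Fin k → Formula k
IsOne o = ∃f (((var zero ⊕ var zero) ≐ var zero) ∧f ((var zero ≺ var (suc o)) ∧f
            ∀f ((var (suc zero) ≺ var zero) ⇒f (¬f (var zero ≺ var (suc (suc o)))))))

IsOne-correct : ∀ (o : Fin k) σ → ⟦ IsOne o ⟧ σ ⇔ σ o ≡ + 1
IsOne-correct o σ = mk⇔ to′ from′
  where
    z+z≡z⇒z≡0 : ∀ z → z + z ≡ z → z ≡ + 0
    z+z≡z⇒z≡0 z z+z≡z = trans (lemma z) (trans (cong (_- z) z+z≡z) (ℤ.+-inverseʳ z))
      where lemma : ∀ z → z ≡ z + z - z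
            lemma = solve-∀
    to′ : ⟦ IsOne o ⟧ σ → σ o ≡ + 1
    to′ (z , z+z≡z , z<σo , nothing-between) with z+z≡z⇒z≡0 z z+z≡z
    ... | refl with σ o ℤ.≟ + 1
    ...   | yes σo≡1 = σo≡1
    ...   | no  σo≢1 = ⊥-elim (nothing-between (+ 1) (+<+ (s≤s z≤n))
                                 (ℤ.≤∧≢⇒< (ℤ.i<j⇒suc[i]≤j z<σo) (σo≢1 ∘ sym)))
    from′ : σ o ≡ + 1 → ⟦ IsOne o ⟧ σ
    from′ σo≡1 = + 0 , refl , subst (+ 0 <_) (sym σo≡1) (+<+ (s≤s z≤n)) ,
      λ w 0<w w<σo → NonNeg-+-≢-[1+] (<⇒NonNeg 0<w) (<⇒NonNeg (subst (w <_) σo≡1 w<σo)) (lemma w)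
      where lemma : ∀ w → (w - + 0 - + 1) + (+ 1 - w - + 1) ≡ -[1+ 0 ]
            lemma = solve-∀

consToSnoc : ∀ m → Fin (suc m) → Fin (suc m)
consToSnoc m zero    = fromℕ m
consToSnoc m (suc i) = inject₁ i

∷ʳᵥ-fromℕ : ∀ m (as : Val m) b → (as ∷ʳᵥ b) (fromℕ m) ≡ b
∷ʳᵥ-fromℕ zero    as b = refl
∷ʳᵥ-fromℕ (suc m) as b = ∷ʳᵥ-fromℕ m (tail as) b

∷ʳᵥ-inject₁ : ∀ m (as : Val m) b i → (as ∷ʳᵥ b) (inject₁ i) ≡ as i
∷ʳᵥ-inject₁ (suc m) as b zero    = refl
∷ʳᵥ-inject₁ (suc m) as b (suc i) = ∷ʳᵥ-inject₁ m (tail as) b i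

∷ʳᵥ-consToSnoc : ∀ m (as : Val m) b i → (as ∷ʳᵥ b) (consToSnoc m i) ≡ (b ∷ᵥ as) i
∷ʳᵥ-consToSnoc m as b zero    = ∷ʳᵥ-fromℕ m as b
∷ʳᵥ-consToSnoc m as b (suc i) = ∷ʳᵥ-inject₁ m as b i

snocToCons : ∀ m → Fin (suc m) → Fin (suc m)
snocToCons zero    zero    = zero
snocToCons (suc m) zero    = suc zero
snocToCons (suc m) (suc j) = liftRenaming suc (snocToCons m j)

∷ᵥ-snocToCons : ∀ m (as : Val m) x j → (x ∷ᵥ as) (snocToCons m j) ≡ (as ∷ʳᵥ x) j
∷ᵥ-snocToCons zero    as x zero    = refl
∷ᵥ-snocToCons (suc m) as x zero    = refl
∷ᵥ-snocToCons (suc m) as x (suc j) with snocToCons m j | ∷ᵥ-snocToCons m (tail as) x j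
... | zero  | eq = eq
... | suc _ | eq = eq

-- φ counts its last variable, while elimination acts on variable 0.
moveLastToFront : ∀ m → QF (suc m) → QF (suc m)
moveLastToFront m θ = substQ θ (varL ∘ snocToCons m)

moveLastToFront-correct : ∀ m (θ : QF (suc m)) as x →
                          ⟦ moveLastToFront m θ ⟧q (x ∷ᵥ as) ⇔ ⟦ θ ⟧q (as ∷ʳᵥ x)
moveLastToFront-correct m θ as x = ⟦⟧q-cong θ pointwise ⇔-∘ substQ-correct θ _ (x ∷ᵥ as)
  where pointwise : ∀ j → evalL (varL (snocToCons m j)) (x ∷ᵥ as) ≡ (as ∷ʳᵥ x) j
        pointwise j = trans (evalL-var (snocToCons m j) (x ∷ᵥ as)) (∷ᵥ-snocToCons m as x j)

closeFormula : ∀ m → LinFormula (suc m) → Formula (suc m)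
closeFormula m Ψ = ∃f (IsOne zero ∧f toFormula Ψ (suc ∘ consToSnoc m) zero)

closeFormula-correct : ∀ m (Ψ : LinFormula (suc m)) as b →
                       ⟦ closeFormula m Ψ ⟧ (as ∷ʳᵥ b) ⇔ ⟦ Ψ ⟧ℓ (b ∷ᵥ as)
closeFormula-correct m Ψ as b = mk⇔
  (λ (o , isOne , p) → to (Ψ⇔ o (to (IsOne-correct zero (o ∷ᵥ (as ∷ʳᵥ b))) isOne)) p)
  (λ p → + 1 , from (IsOne-correct zero ((+ 1) ∷ᵥ (as ∷ʳᵥ b))) refl , from (Ψ⇔ (+ 1) refl) p)
  where
    Ψ⇔ : ∀ o → o ≡ + 1 →
         ⟦ toFormula Ψ (suc ∘ consToSnoc m) zero ⟧ (o ∷ᵥ (as ∷ʳᵥ b)) ⇔ ⟦ Ψ ⟧ℓ (b ∷ᵥ as)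
    Ψ⇔ o o≡1 = ⟦⟧ℓ-cong Ψ (∷ʳᵥ-consToSnoc m as b) ⇔-∘
               toFormula-correct Ψ (suc ∘ consToSnoc m) zero (o ∷ᵥ (as ∷ʳᵥ b)) o≡1

∑< : ℕ → (ℕ → ℕ) → ℕ
∑< zero    G = 0
∑< (suc q) G = ∑< q G ℕ.+ G q

∑<-cong : ∀ q {G H} → (∀ i → i ℕ.< q → G i ≡ H i) → ∑< q G ≡ ∑< q H
∑<-cong zero    G≗H = refl
∑<-cong (suc q) G≗H = cong₂ ℕ._+_ (∑<-cong q λ i i<q → G≗H i (ℕ.m≤n⇒m≤1+n i<q)) (G≗H q ℕ.≤-refl)

∑<-zero : ∀ q {G} → (∀ i → i ℕ.< q → G i ≡ 0) → ∑< q G ≡ 0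
∑<-zero q G≗0 = trans (∑<-cong q G≗0) (zeros q)
  where
    zeros : ∀ q → ∑< q (λ _ → 0) ≡ 0
    zeros zero    = refl
    zeros (suc q) = trans (ℕ.+-identityʳ _) (zeros q)

∑<-+ : ∀ p q G → ∑< (p ℕ.+ q) G ≡ ∑< p G ℕ.+ ∑< q (λ i → G (p ℕ.+ i))
∑<-+ p zero    G = trans (cong (λ r → ∑< r G) (ℕ.+-identityʳ p)) (sym (ℕ.+-identityʳ _))
∑<-+ p (suc q) G = trans (cong (λ r → ∑< r G) (ℕ.+-suc p q))
                         (trans (cong (ℕ._+ G (p ℕ.+ q)) (∑<-+ p q G)) (ℕ.+-assoc (∑< p G) _ _))

∑<-distrib : ∀ q G H → ∑< q (λ i → G i ℕ.+ H i) ≡ ∑< q G ℕ.+ ∑< q H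
∑<-distrib zero    G H = refl
∑<-distrib (suc q) G H =
  trans (cong (ℕ._+ (G q ℕ.+ H q)) (∑<-distrib q G H)) (lemma (∑< q G) (∑< q H) (G q) (H q))
  where lemma : ∀ a b c d → a ℕ.+ b ℕ.+ (c ℕ.+ d) ≡ a ℕ.+ c ℕ.+ (b ℕ.+ d)
        lemma = ℕ-Solver.solve-∀

∑<-single : ∀ n k (G : ℕ → ℕ) → (∀ i → i ≢ k → G i ≡ 0) → k ℕ.< n → ∑< n G ≡ G k
∑<-single (suc n) k G G≗0 k<1+n with k ℕ.≟ n
... | yes refl = cong (ℕ._+ G k) (∑<-zero k λ i i<k → G≗0 i (ℕ.<⇒≢ i<k))
... | no  k≢n  = trans (cong₂ ℕ._+_ (∑<-single n k G G≗0 (ℕ.≤∧≢⇒< (ℕ.≤-pred k<1+n) k≢n))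
                                   (G≗0 n (k≢n ∘ sym)))
                       (ℕ.+-identityʳ _)

∑from : ℤ → ℕ → (ℤ → ℕ) → ℕ
∑from lo n g = ∑< n (λ i → g (lo + + i))

InRange : ℤ → ℕ → ℤ → Set
InRange lo n y = lo ≤ y × y < lo + + n

OutOfRange : ℤ → ℕ → ℤ → Set
OutOfRange lo n y = y < lo ⊎ lo + + n ≤ y

OutOfRange⇒¬InRange : ∀ {lo n y} → OutOfRange lo n y → ¬ InRange lo n y
OutOfRange⇒¬InRange (inj₁ y<lo)   (lo≤y , _)   = ℤ.<-irrefl refl (ℤ.<-≤-trans y<lo lo≤y)
OutOfRange⇒¬InRange (inj₂ lo+n≤y) (_ , y<lo+n) = ℤ.<-irrefl refl (ℤ.<-≤-trans y<lo+n lo+n≤y)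

VanishesOutside : (ℤ → ℕ) → ℤ → ℕ → Set
VanishesOutside g lo n = ∀ y → OutOfRange lo n y → g y ≡ 0

∑from-widen : ∀ g {lo n} a k r → VanishesOutside g lo n → a + + k ≡ lo →
              ∑from a (k ℕ.+ n ℕ.+ r) g ≡ ∑from lo n g
∑from-widen g {lo} {n} a k r g≗0 a+k≡lo = begin
  ∑from a (k ℕ.+ n ℕ.+ r) g
    ≡⟨ ∑<-+ (k ℕ.+ n) r _ ⟩
  ∑from a (k ℕ.+ n) g ℕ.+ ∑< r (λ i → g (a + + (k ℕ.+ n ℕ.+ i)))
    ≡⟨ cong (∑from a (k ℕ.+ n) g ℕ.+_) (∑<-zero r λ i _ → g≗0 _ (inj₂ (above i))) ⟩
  ∑from a (k ℕ.+ n) g ℕ.+ 0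
    ≡⟨ ℕ.+-identityʳ _ ⟩
  ∑from a (k ℕ.+ n) g
    ≡⟨ ∑<-+ k n _ ⟩
  ∑from a k g ℕ.+ ∑< n (λ i → g (a + + (k ℕ.+ i)))
    ≡⟨ cong₂ ℕ._+_ (∑<-zero k λ i i<k → g≗0 _ (inj₁ (below i i<k))) (∑<-cong n λ i _ → cong g (shift i)) ⟩
  ∑from lo n g ∎
  where
    open ≡-Reasoning
    below : ∀ i → i ℕ.< k → a + + i < lo
    below i i<k = subst (a + + i <_) a+k≡lo (ℤ.+-monoʳ-< a (+<+ i<k))
    shift : ∀ i → a + + (k ℕ.+ i) ≡ lo + + i
    shift i = trans (cong (_+_ a) (ℤ.pos-+ k i)) (trans (sym (ℤ.+-assoc a (+ k) (+ i))) (cong (_+ + i) a+k≡lo))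
    above : ∀ i → lo + + n ≤ a + + (k ℕ.+ n ℕ.+ i)
    above i = subst (lo + + n ≤_) (sym (trans (lemma a (+ k) (+ n) (+ i)) (cong (λ z → z + + n + + i) a+k≡lo)))
                    (ℤ.i≤i+j (lo + + n) (+ i))
      where lemma : ∀ a k n i → a + (k + n + i) ≡ a + k + n + i
            lemma = solve-∀

𝟙 : {A : Set} → Dec A → ℕ
𝟙 a? = if does a? then 1 else 0

module _ {P : ℤ → Set} (P? : ∀ y → Dec (P y)) where

  enumerate : ℤ → ℕ → List ℤ
  enumerate lo zero    = []
  enumerate lo (suc n) with P? (lo + + n)
  ... | yes _ = lo + + n ∷ enumerate lo n
  ... | no  _ = enumerate lo n

  private
    InRange-suc : ∀ {lo n y} → InRange lo n y → InRange lo (suc n) y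
    InRange-suc {lo} (lo≤y , y<lo+n) = lo≤y , ℤ.<-trans y<lo+n (ℤ.+-monoʳ-< lo (+<+ ℕ.≤-refl))

    <-suc⇒≤ : ∀ lo n {y} → y < lo + + suc n → y ≤ lo + + n
    <-suc⇒≤ lo n {y} y<lo+n+1 = ≤-from-slack _ (slack lo (+ n) y) (<⇒NonNeg y<lo+n+1)
      where slack : ∀ lo n y → lo + (+ 1 + n) - y - + 1 ≡ lo + n - y
            slack = solve-∀

    top-InRange : ∀ lo n → InRange lo (suc n) (lo + + n)
    top-InRange lo n = ℤ.i≤i+j lo (+ n) , ℤ.+-monoʳ-< lo (+<+ ℕ.≤-refl)

  enumerate-sound : ∀ lo n {y} → y ∈ enumerate lo n → P y × InRange lo n y
  enumerate-sound lo (suc n) y∈ with P? (lo + + n) | y∈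
  ... | yes p | here refl = p , top-InRange lo n
  ... | yes _ | there y∈′ = let (p , r) = enumerate-sound lo n y∈′ in p , InRange-suc r
  ... | no _  | y∈′       = let (p , r) = enumerate-sound lo n y∈′ in p , InRange-suc r

  enumerate-complete : ∀ lo n {y} → P y → InRange lo n y → y ∈ enumerate lo n
  enumerate-complete lo zero {y} _ (lo≤y , y<lo+0) =
    ⊥-elim (ℤ.<-irrefl refl (ℤ.≤-<-trans lo≤y (subst (y <_) (ℤ.+-identityʳ lo) y<lo+0)))
  enumerate-complete lo (suc n) {y} py (lo≤y , y<lo+n+1) with y ℤ.≟ lo + + n | P? (lo + + n)
  ... | yes refl | yes _  = here refl
  ... | yes refl | no ¬py = ⊥-elim (¬py py)
  ... | no y≢    | yes _  = there (enumerate-complete lo n py (lo≤y , y<lo+n))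
    where y<lo+n = ℤ.≤∧≢⇒< (<-suc⇒≤ lo n y<lo+n+1) y≢
  ... | no y≢    | no _   = enumerate-complete lo n py (lo≤y , y<lo+n)
    where y<lo+n = ℤ.≤∧≢⇒< (<-suc⇒≤ lo n y<lo+n+1) y≢

  enumerate-unique : ∀ lo n → Unique (enumerate lo n)
  enumerate-unique lo zero    = []
  enumerate-unique lo (suc n) with P? (lo + + n)
  ... | yes _ = All.tabulate (λ y∈ top≡y → ℤ.<-irrefl (sym top≡y) (proj₂ (proj₂ (enumerate-sound lo n y∈))))
                ∷ enumerate-unique lo n
  ... | no _  = enumerate-unique lo n

  length-enumerate : ∀ lo n → length (enumerate lo n) ≡ ∑from lo n (𝟙 ∘ P?)
  length-enumerate lo zero    = refl
  length-enumerate lo (suc n) with P? (lo + + n)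
  ... | yes _ = trans (cong suc (length-enumerate lo n)) (ℕ.+-comm 1 _)
  ... | no  _ = trans (length-enumerate lo n) (sym (ℕ.+-identityʳ _))

  countIs-enumerate : ∀ lo n → (∀ y → P y → InRange lo n y) → CountIs P (+ ∑from lo n (𝟙 ∘ P?))
  countIs-enumerate lo n bounded =
    enumerate lo n , enumerate-unique lo n ,
    (λ a → (λ pa → enumerate-complete lo n pa (bounded a pa)) , (proj₁ ∘ enumerate-sound lo n)) ,
    cong +_ (sym (length-enumerate lo n))

∈-─ : ∀ {A : Set} {x y : A} ys (x∈ : x ∈ ys) → y ∈ ys → x ≢ y → y ∈ ys ─ x∈
∈-─ (z ∷ ys) (here refl) (here refl) x≢y = ⊥-elim (x≢y refl)
∈-─ (z ∷ ys) (here refl) (there y∈)  x≢y = y∈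
∈-─ (z ∷ ys) (there x∈)  (here y≡z)  x≢y = here y≡z
∈-─ (z ∷ ys) (there x∈)  (there y∈)  x≢y = there (∈-─ ys x∈ y∈ x≢y)

∉-∷ : ∀ {A : Set} {y v : A} {vs} → y ∉ vs → y ≢ v → y ∉ v ∷ vs
∉-∷ y∉vs y≢v (here y≡v)  = y≢v y≡v
∉-∷ y∉vs y≢v (there y∈vs) = y∉vs y∈vs

∉-∷-⇔ : ∀ {A : Set} {v w : A} {ws} → (v ≢ w × v ∉ ws) ⇔ (v ∉ w ∷ ws)
∉-∷-⇔ = mk⇔ (λ (v≢w , v∉ws) → ∉-∷ v∉ws v≢w) (λ v∉ → (v∉ ∘ here) , (v∉ ∘ there))

Unique-⊆⇒length-≤ : ∀ {A : Set} (xs ys : List A) → Unique xs → (∀ {y} → y ∈ xs → y ∈ ys) →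
                    length xs ℕ.≤ length ys
Unique-⊆⇒length-≤ []       ys _ _ = z≤n
Unique-⊆⇒length-≤ (x ∷ xs) ys (x∉xs ∷ xs!) xs⊆ys =
  subst (suc (length xs) ℕ.≤_) (sym (List.length-removeAt′ ys (Any.index x∈ys)))
    (s≤s (Unique-⊆⇒length-≤ xs (ys ─ x∈ys) xs!
            (λ y∈xs → ∈-─ ys x∈ys (xs⊆ys (there y∈xs)) (All.lookup x∉xs y∈xs))))
  where x∈ys = xs⊆ys (here refl)

CountIs-unique : ∀ {P : ℤ → Set} {b b′} → CountIs P b → CountIs P b′ → b ≡ b′
CountIs-unique (xs , xs! , xs⇔ , b≡) (ys , ys! , ys⇔ , b′≡) =
  trans b≡ (trans (cong +_ (ℕ.≤-antisym
    (Unique-⊆⇒length-≤ xs ys xs! λ y∈xs → proj₁ (ys⇔ _) (proj₂ (xs⇔ _) y∈xs))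
    (Unique-⊆⇒length-≤ ys xs ys! λ y∈ys → proj₁ (xs⇔ _) (proj₂ (ys⇔ _) y∈ys)))) (sym b′≡))

-- Each value of vs is counted once, at its last occurrence.
∑distinct : (ℤ → ℕ) → List ℤ → ℕ
∑distinct g []       = 0
∑distinct g (v ∷ vs) = (if does (v ∈? vs) then 0 else g v) ℕ.+ ∑distinct g vs

∑distinct-cong : ∀ {g h} vs → (∀ {y} → y ∈ vs → g y ≡ h y) → ∑distinct g vs ≡ ∑distinct h vs
∑distinct-cong []       g≗h = refl
∑distinct-cong (v ∷ vs) g≗h with v ∈? vs
... | yes _ = ∑distinct-cong vs (g≗h ∘ there)
... | no  _ = cong₂ ℕ._+_ (g≗h (here refl)) (∑distinct-cong vs (g≗h ∘ there))

onlyAt : ℤ → (ℤ → ℕ) → ℤ → ℕ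
onlyAt v g y = if does (y ℤ.≟ v) then g y else 0

exceptAt : ℤ → (ℤ → ℕ) → ℤ → ℕ
exceptAt v g y = if does (y ℤ.≟ v) then 0 else g y

∑from-onlyAt : ∀ g {lo n} v → VanishesOutside g lo n → ∑from lo n (onlyAt v g) ≡ g v
∑from-onlyAt g {lo} {n} v g≗0 with lo ℤ.≤? v | v ℤ.<? lo + + n
... | yes lo≤v | yes v<lo+n = trans (∑<-single n i₀ _ off-i₀ i₀<n) on-i₀
  where
    i₀ = ∣ v - lo ∣
    i₀≡ : + i₀ ≡ v - lo
    i₀≡ = ℤ.0≤i⇒+∣i∣≡i (≤⇒NonNeg lo≤v)
    lo+i₀≡v : lo + + i₀ ≡ v
    lo+i₀≡v = trans (cong (_+_ lo) i₀≡) (lemma lo v)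
      where lemma : ∀ lo v → lo + (v - lo) ≡ v
            lemma = solve-∀
    i₀<n : i₀ ℕ.< n
    i₀<n = ℤ.drop‿+<+ (<-from-slack _ (trans (slack lo v (+ n)) (cong (λ z → + n - z - + 1) (sym i₀≡)))
                                       (<⇒NonNeg v<lo+n))
      where slack : ∀ lo v n → lo + n - v - + 1 ≡ n - (v - lo) - + 1
            slack = solve-∀
    off-i₀ : ∀ i → i ≢ i₀ → onlyAt v g (lo + + i) ≡ 0
    off-i₀ i i≢i₀ with lo + + i ℤ.≟ v
    ... | yes lo+i≡v = ⊥-elim (i≢i₀ (ℤ.+-injective (∙-cancelˡ lo _ _ (trans lo+i≡v (sym lo+i₀≡v)))))
    ... | no  _      = refl
    on-i₀ : onlyAt v g (lo + + i₀) ≡ g v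
    on-i₀ rewrite lo+i₀≡v with v ℤ.≟ v
    ... | yes _  = refl
    ... | no v≢v = ⊥-elim (v≢v refl)
... | no lo≰v | _ = trans (∑<-zero n λ i _ → off i) (sym (g≗0 v (inj₁ (ℤ.≰⇒> lo≰v))))
  where
    off : ∀ i → onlyAt v g (lo + + i) ≡ 0
    off i with lo + + i ℤ.≟ v
    ... | yes refl = ⊥-elim (lo≰v (ℤ.i≤i+j lo (+ i)))
    ... | no  _    = refl
... | yes _ | no v≮lo+n = trans (∑<-zero n λ i i<n → off i i<n) (sym (g≗0 v (inj₂ (ℤ.≮⇒≥ v≮lo+n))))
  where
    off : ∀ i → i ℕ.< n → onlyAt v g (lo + + i) ≡ 0
    off i i<n with lo + + i ℤ.≟ v
    ... | yes refl = ⊥-elim (v≮lo+n (ℤ.+-monoʳ-< lo (+<+ i<n)))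
    ... | no  _    = refl

onlyAt+exceptAt : ∀ v g y → g y ≡ exceptAt v g y ℕ.+ onlyAt v g y
onlyAt+exceptAt v g y with y ℤ.≟ v
... | yes _ = refl
... | no  _ = sym (ℕ.+-identityʳ (g y))

∑from-∑distinct : ∀ vs g {lo n} → VanishesOutside g lo n → (∀ y → y ∉ vs → g y ≡ 0) →
                  ∑from lo n g ≡ ∑distinct g vs
∑from-∑distinct [] g {lo} {n} _ g≗0 = ∑<-zero n λ i _ → g≗0 (lo + + i) λ ()
∑from-∑distinct (v ∷ vs) g {lo} {n} g≗0 g≗0′ with v ∈? vs
... | yes v∈vs = ∑from-∑distinct vs g g≗0 λ y y∉vs → g≗0′ y (∉-∷ y∉vs λ { refl → y∉vs v∈vs })
... | no  v∉vs = begin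
  ∑from lo n g                                       ≡⟨ ∑<-cong n (λ i _ → onlyAt+exceptAt v g (lo + + i)) ⟩
  ∑< n (λ i → exceptAt v g (lo + + i) ℕ.+ onlyAt v g (lo + + i)) ≡⟨ ∑<-distrib n _ _ ⟩
  ∑from lo n (exceptAt v g) ℕ.+ ∑from lo n (onlyAt v g)   ≡⟨ cong₂ ℕ._+_ IH (∑from-onlyAt g v g≗0) ⟩
  ∑distinct g vs ℕ.+ g v                             ≡⟨ ℕ.+-comm _ (g v) ⟩
  g v ℕ.+ ∑distinct g vs                             ∎
  where
    open ≡-Reasoning
    exceptAt-off : ∀ y → y ∉ vs → exceptAt v g y ≡ 0
    exceptAt-off y y∉vs with y ℤ.≟ v
    ... | yes _   = refl
    ... | no  y≢v = g≗0′ y (∉-∷ y∉vs y≢v)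
    exceptAt-outside : VanishesOutside (exceptAt v g) lo n
    exceptAt-outside y out with y ℤ.≟ v
    ... | yes _ = refl
    ... | no  _ = g≗0 y out
    exceptAt-on-vs : ∀ {y} → y ∈ vs → exceptAt v g y ≡ g y
    exceptAt-on-vs {y} y∈vs with y ℤ.≟ v
    ... | yes refl = ⊥-elim (v∉vs y∈vs)
    ... | no  _    = refl
    IH : ∑from lo n (exceptAt v g) ≡ ∑distinct g vs
    IH = trans (∑from-∑distinct vs (exceptAt v g) exceptAt-outside exceptAt-off) (∑distinct-cong vs exceptAt-on-vs)

-- Runs of a decidable predicate along an arithmetic progression

module Runs {P : ℤ → Set} (P? : ∀ y → Dec (P y)) (d : ℕ) where

  D : ℤ
  D = + suc d

  run : ℕ → ℤ → ℕ
  run zero    y = 0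
  run (suc k) y with P? y
  ... | yes _ = suc (run k (y - D))
  ... | no  _ = 0

  topRun : ℕ → ℤ → ℕ
  topRun k e with P? e | P? (e + D)
  ... | yes _ | no _ = run k e
  ... | _     | _    = 0

  IsRunLength : ℤ → ℤ → Set
  IsRunLength y c = NonNeg c × (∀ j → NonNeg j × j < c → P (y - j * D)) × ¬ P (y - c * D)

  𝟙-yes : ∀ {y} → P y → 𝟙 (P? y) ≡ 1
  𝟙-yes {y} p with P? y
  ... | yes _ = refl
  ... | no ¬p = ⊥-elim (¬p p)

  𝟙-no : ∀ {y} → ¬ P y → 𝟙 (P? y) ≡ 0
  𝟙-no {y} ¬p with P? y
  ... | yes p = ⊥-elim (¬p p)
  ... | no  _ = refl

  run-yes : ∀ k {y} → P y → run (suc k) y ≡ suc (run k (y - D))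
  run-yes k {y} p with P? y
  ... | yes _ = refl
  ... | no ¬p = ⊥-elim (¬p p)

  run-no : ∀ k {y} → ¬ P y → run (suc k) y ≡ 0
  run-no k {y} ¬p with P? y
  ... | yes p = ⊥-elim (¬p p)
  ... | no  _ = refl

  topRun-top : ∀ k {e} → P e → ¬ P (e + D) → topRun k e ≡ run k e
  topRun-top k {e} p ¬p⁺ with P? e | P? (e + D)
  ... | yes _ | no _   = refl
  ... | no ¬p | _      = ⊥-elim (¬p p)
  ... | yes _ | yes p⁺ = ⊥-elim (¬p⁺ p⁺)

  topRun-below : ∀ k {e} → P (e + D) → topRun k e ≡ 0
  topRun-below k {e} p⁺ with P? e | P? (e + D)
  ... | yes _ | no ¬p⁺ = ⊥-elim (¬p⁺ p⁺)
  ... | yes _ | yes _  = refl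
  ... | no _  | _      = refl

  topRun-absent : ∀ k {e} → ¬ P e → topRun k e ≡ 0
  topRun-absent k {e} ¬p with P? e | P? (e + D)
  ... | yes p | _ = ⊥-elim (¬p p)
  ... | no _  | _ = refl

  topRun-notTop : ∀ k {e} → ¬ (P e × ¬ P (e + D)) → topRun k e ≡ 0
  topRun-notTop k {e} ¬top = by-cases (P? e) (P? (e + D))
    where
      by-cases : Dec (P e) → Dec (P (e + D)) → topRun k e ≡ 0
      by-cases (no ¬p) _        = topRun-absent k ¬p
      by-cases (yes _) (yes p⁺) = topRun-below k p⁺
      by-cases (yes p) (no ¬p⁺) = ⊥-elim (¬top (p , ¬p⁺))

  -- run (suc k) (e + D) = 𝟙[e + D ∈ P] · (1 + run k e), which telescopes.
  telescoping-step : ∀ k e → run k e ≡ run (suc k) e →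
                     𝟙 (P? (e + D)) ℕ.+ run (suc k) e ≡ run (suc k) (e + D) ℕ.+ topRun (suc k) e
  telescoping-step k e stable = by-cases (P? (e + D)) (P? e)
    where
      open ≡-Reasoning
      by-cases : Dec (P (e + D)) → Dec (P e) →
                 𝟙 (P? (e + D)) ℕ.+ run (suc k) e ≡ run (suc k) (e + D) ℕ.+ topRun (suc k) e
      by-cases (yes p⁺) _ = begin
        𝟙 (P? (e + D)) ℕ.+ run (suc k) e         ≡⟨ cong₂ ℕ._+_ (𝟙-yes p⁺) (sym stable) ⟩
        suc (run k e)                            ≡⟨ cong (suc ∘ run k) (sym (lemma e D)) ⟩
        suc (run k (e + D - D))                  ≡⟨ sym (run-yes k p⁺) ⟩
        run (suc k) (e + D)                      ≡⟨ sym (ℕ.+-identityʳ _) ⟩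
        run (suc k) (e + D) ℕ.+ 0                ≡⟨ cong (run (suc k) (e + D) ℕ.+_) (sym (topRun-below (suc k) p⁺)) ⟩
        run (suc k) (e + D) ℕ.+ topRun (suc k) e ∎
        where lemma : ∀ e D → e + D - D ≡ e
              lemma = solve-∀
      by-cases (no ¬p⁺) (yes p) = begin
        𝟙 (P? (e + D)) ℕ.+ run (suc k) e         ≡⟨ cong (ℕ._+ run (suc k) e) (𝟙-no ¬p⁺) ⟩
        run (suc k) e                            ≡⟨ sym (topRun-top (suc k) p ¬p⁺) ⟩
        topRun (suc k) e                         ≡⟨ cong (ℕ._+ topRun (suc k) e) (sym (run-no k ¬p⁺)) ⟩
        run (suc k) (e + D) ℕ.+ topRun (suc k) e ∎
      by-cases (no ¬p⁺) (no ¬p) =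
        trans (cong₂ ℕ._+_ (𝟙-no ¬p⁺) (run-no k ¬p))
              (sym (cong₂ ℕ._+_ (run-no k ¬p⁺) (topRun-absent (suc k) ¬p)))

  run-members : ∀ k y j → j ℕ.< run k y → P (y - + j * D)
  run-members (suc k) y j j<run with P? y
  run-members (suc k) y zero    _           | yes p = subst P (lemma y D) p
    where lemma : ∀ y D → y ≡ y - + 0 * D
          lemma = solve-∀
  run-members (suc k) y (suc j) (s≤s j<run) | yes p = subst P (lemma y (+ j) D) (run-members k (y - D) j j<run)
    where lemma : ∀ y j D → y - D - j * D ≡ y - (+ 1 + j) * D
          lemma = solve-∀

  module Bounded (lo : ℤ) (n : ℕ) (bounded : ∀ y → P y → InRange lo n y) where

    absent-outside : ∀ {y} → OutOfRange lo n y → ¬ P y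
    absent-outside out p = OutOfRange⇒¬InRange out (bounded _ p)

    below-after : ∀ {y} k → y < lo + + k → y - + k * D < lo
    below-after {y} k y<lo+k =
      <-from-slack _ (slack lo y (+ k) (+ d)) (NonNeg-+ (<⇒NonNeg y<lo+k) (NonNeg-* (NonNeg-ℕ k) (NonNeg-ℕ d)))
      where slack : ∀ lo y k d → (lo + k - y - + 1) + k * d ≡ lo - (y - k * (+ 1 + d)) - + 1
            slack = solve-∀

    run-stable : ∀ k y → y - + k * D < lo → run k y ≡ run (suc k) y
    run-stable zero y y<lo = sym (run-no 0 (absent-outside (inj₁ (subst (_< lo) (lemma y D) y<lo))))
      where lemma : ∀ y D → y - + 0 * D ≡ y
            lemma = solve-∀
    run-stable (suc k) y below with P? y
    ... | yes _ = cong suc (run-stable k (y - D) (subst (_< lo) (lemma y (+ k) D) below))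
      where lemma : ∀ y k D → y - (+ 1 + k) * D ≡ y - D - k * D
            lemma = solve-∀
    ... | no  _ = refl

    run-end : ∀ k y → y - + k * D < lo → ¬ P (y - + run k y * D)
    run-end zero    y below = absent-outside (inj₁ below)
    run-end (suc k) y below with P? y
    ... | yes _ = run-end k (y - D) (subst (_< lo) (lemma y (+ k) D) below) ∘ subst P (lemma y (+ run k (y - D)) D)
      where lemma : ∀ y k D → y - (+ 1 + k) * D ≡ y - D - k * D
            lemma = solve-∀
    ... | no ¬p = ¬p ∘ subst P (lemma y D)
      where lemma : ∀ y D → y - + 0 * D ≡ y
            lemma = solve-∀

    IsRunLength⇔ : ∀ k y c → y - + k * D < lo → IsRunLength y c ⇔ (c ≡ + run k y)
    IsRunLength⇔ k y c below = mk⇔ to′ from′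
      where
        to′ : IsRunLength y c → c ≡ + run k y
        to′ (0≤c , members , end) with ℕ.<-cmp ∣ c ∣ (run k y) | ℤ.0≤i⇒+∣i∣≡i 0≤c
        ... | tri< c<run _ _ | c≡ = ⊥-elim (end (subst (λ z → P (y - z * D)) c≡ (run-members k y ∣ c ∣ c<run)))
        ... | tri≈ _ c≡run _ | c≡ = trans (sym c≡) (cong +_ c≡run)
        ... | tri> _ _ run<c | c≡ =
          ⊥-elim (run-end k y below (members (+ run k y) (NonNeg-ℕ _ , subst (+ run k y <_) c≡ (+<+ run<c))))
        from′ : c ≡ + run k y → IsRunLength y c
        from′ refl = NonNeg-ℕ _ , members , run-end k y below
          where
            members : ∀ j → NonNeg j × j < + run k y → P (y - j * D)
            members j (0≤j , j<run) with ℤ.0≤i⇒+∣i∣≡i 0≤j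
            ... | j≡ = subst (λ z → P (y - z * D)) j≡ (run-members k y ∣ j ∣ (ℤ.drop‿+<+ (subst (_< _) (sym j≡) j<run)))

    N : ℕ
    N = n ℕ.+ suc d

    -- Truncation at this length never bites: every run inside [lo, lo + n) is shorter.
    cap : ℕ
    cap = suc N

    below-after-cap : ∀ {y} → P y → y - + cap * D < lo
    below-after-cap {y} p =
      below-after cap (ℤ.<-≤-trans (proj₂ (bounded y p)) (ℤ.+-monoʳ-≤ lo (+≤+ (ℕ.m≤n⇒m≤1+n (ℕ.m≤m+n n (suc d))))))

    𝟙-vanishes : VanishesOutside (𝟙 ∘ P?) lo n
    𝟙-vanishes y out = 𝟙-no (absent-outside out)

    run-vanishes : VanishesOutside (run cap) lo n
    run-vanishes y out = run-no N (absent-outside out)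

    topRun-vanishes : VanishesOutside (topRun cap) lo n
    topRun-vanishes y out = topRun-absent cap (absent-outside out)

    -- Sum telescoping-step over the window [lo - D, lo + n + D); the two sums of run that
    -- appear are shifts of each other and cancel, as run vanishes outside [lo, lo + n).
    ∑𝟙≡∑topRun : ∑from lo n (𝟙 ∘ P?) ≡ ∑from lo n (topRun cap)
    ∑𝟙≡∑topRun = ℕ.+-cancelʳ-≡ (∑from lo n (run cap)) _ _ (begin
      ∑from lo n (𝟙 ∘ P?) ℕ.+ ∑from lo n (run cap)
        ≡⟨ sym (cong₂ ℕ._+_ (shift (𝟙 ∘ P?) 𝟙-vanishes) (widen (run cap) run-vanishes)) ⟩
      ∑from a M (λ y → 𝟙 (P? (y + D))) ℕ.+ ∑from a M (run cap)
        ≡⟨ sym (∑<-distrib M _ _) ⟩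
      ∑< M (λ i → 𝟙 (P? (a + + i + D)) ℕ.+ run cap (a + + i))
        ≡⟨ ∑<-cong M (λ i i<M → telescoping-step N (a + + i) (run-stable N _ (below-after N (window i i<M)))) ⟩
      ∑< M (λ i → run cap (a + + i + D) ℕ.+ topRun cap (a + + i))
        ≡⟨ ∑<-distrib M _ _ ⟩
      ∑from a M (λ y → run cap (y + D)) ℕ.+ ∑from a M (topRun cap)
        ≡⟨ cong₂ ℕ._+_ (shift (run cap) run-vanishes) (widen (topRun cap) topRun-vanishes) ⟩
      ∑from lo n (run cap) ℕ.+ ∑from lo n (topRun cap)
        ≡⟨ ℕ.+-comm (∑from lo n (run cap)) _ ⟩
      ∑from lo n (topRun cap) ℕ.+ ∑from lo n (run cap) ∎)
      where
        open ≡-Reasoning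
        a = lo - D
        M = suc d ℕ.+ n ℕ.+ suc d
        widen : ∀ g → VanishesOutside g lo n → ∑from a M g ≡ ∑from lo n g
        widen g g≗0 = ∑from-widen g a (suc d) (suc d) g≗0 (lemma lo D)
          where lemma : ∀ lo D → lo - D + D ≡ lo
                lemma = solve-∀
        shift : ∀ g → VanishesOutside g lo n → ∑from a M (λ y → g (y + D)) ≡ ∑from lo n g
        shift g g≗0 = begin
          ∑from a M (λ y → g (y + D))          ≡⟨ ∑<-cong M (λ i _ → cong g (lemma lo D (+ i))) ⟩
          ∑from lo M g                          ≡⟨ cong (λ r → ∑from lo r g) (M≡ d n) ⟩
          ∑from lo (0 ℕ.+ n ℕ.+ (suc d ℕ.+ suc d)) g ≡⟨ ∑from-widen g lo 0 _ g≗0 (ℤ.+-identityʳ lo) ⟩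
          ∑from lo n g                          ∎
          where
            lemma : ∀ lo D i → lo - D + i + D ≡ lo + i
            lemma = solve-∀
            M≡ : ∀ d n → suc d ℕ.+ n ℕ.+ suc d ≡ 0 ℕ.+ n ℕ.+ (suc d ℕ.+ suc d)
            M≡ = ℕ-Solver.solve-∀
        window : ∀ i → i ℕ.< M → a + + i < lo + + N
        window i i<M = <-from-slack _ (slack lo (+ i) (+ n) (+ d)) (<⇒NonNeg (+<+ i<M))
          where slack : ∀ lo i n d → (+ 1 + d) + n + (+ 1 + d) - i - + 1
                                   ≡ lo + (n + (+ 1 + d)) - (lo - (+ 1 + d) + i) - + 1
                slack = solve-∀

    count-by-tops : ∀ vs → (∀ e → P e → ¬ P (e + D) → e ∈ vs) →
                    ∑from lo n (𝟙 ∘ P?) ≡ ∑distinct (topRun cap) vs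
    count-by-tops vs tops∈vs =
      trans ∑𝟙≡∑topRun (∑from-∑distinct vs (topRun cap) topRun-vanishes off-vs)
      where
        off-vs : ∀ e → e ∉ vs → topRun cap e ≡ 0
        off-vs e e∉vs = topRun-notTop cap λ (p , ¬p⁺) → e∉vs (tops∈vs e p ¬p⁺)

-- The counting formula

candidates : List (Lin n) → ℕ → List (Lin n)
candidates us d = concatMap (shiftsDown d) us
  where shiftsDown : ℕ → Lin n → List (Lin n)
        shiftsDown d u = map (λ j → u -L constL (+ j)) (upTo (suc d))

values : Val n → List (Lin n) → List ℤ
values ρ = map (λ e → evalL e ρ)

nearBoundary⇒candidate : ∀ d (θ : QF (suc n)) {y ρ} → NearBoundary d θ y ρ →
                         y ∈ values ρ (candidates (boundaryPoints θ) d)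
nearBoundary⇒candidate d θ {y} {ρ} near with find near
... | u , u∈us , j , j≤d , y≡ =
  subst (_∈ _) (sym (trans y≡ (sym (evalL-minusConst u (+ j) ρ)))) (∈-map⁺ (λ e → evalL e ρ) term∈)
  where
    term∈ : u -L constL (+ j) ∈ candidates (boundaryPoints θ) d
    term∈ = ∈-concatMap⁺ _ (Any.map (λ { refl → ∈-map⁺ _ (∈-upTo⁺ j≤d) }) u∈us)

module CountFormula {m} (θ : QF (suc m)) (d : ℕ) where

  D : ℤ
  D = + suc d

  -- The formula binds further variables, so the parameters of θ are passed as terms env.
  extend : Lin k → (Fin m → Lin k) → Fin (suc m) → Lin k
  extend e env zero    = e
  extend e env (suc i) = env i

  infix 8 _at_
  _at_ : Lin k → (Fin m → Lin k) → QF k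
  e at env = substQ θ (extend e env)

  wkEnv : (Fin m → Lin k) → Fin m → Lin (suc k)
  wkEnv env = wkL ∘ env

  infixl 6 _-D·_
  _-D·_ : Lin k → Lin k → Lin k
  e -D· c = e +L (- D) *L c

  BoundedF : (Fin m → Lin k) → LinFormula k
  BoundedF env = ∃ℓ (∀ℓ (atom (y at wkEnv (wkEnv env)) ⇒ℓ atom (y ≤q L ∧q -[1+ 0 ] *L L ≤q y)))
    where
      y L : Lin (suc (suc _))
      y = varL zero
      L = varL (suc zero)

  distinctFrom : Lin k → List (Lin k) → QF k
  distinctFrom e []       = ⊤q
  distinctFrom e (t ∷ ts) = e ≢q t ∧q distinctFrom e ts

  IsLastTopF : Lin m → List (Lin m) → (Fin m → Lin k) → LinFormula k
  IsLastTopF e es env =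
    atom (distinctFrom e′ (map (λ t → substL t env) es)) ∧ℓ atom (e′ at env) ∧ℓ ¬ℓ atom ((e′ +L constL D) at env)
    where e′ = substL e env

  IsRunLengthF : Lin k → Lin k → (Fin m → Lin k) → LinFormula k
  IsRunLengthF e c env =
    atom (constL (+ 0) ≤q c) ∧ℓ
    ∀ℓ (atom (constL (+ 0) ≤q varL zero ∧q varL zero <q wkL c) ⇒ℓ atom ((wkL e -D· varL zero) at wkEnv env)) ∧ℓ
    ¬ℓ atom ((e -D· c) at env)

  ContributionF : Lin m → List (Lin m) → (Fin m → Lin (suc k)) → LinFormula (suc k)
  ContributionF e es env =
    (IsLastTopF e es env ∧ℓ IsRunLengthF (substL e env) (varL zero) env) ∨ℓ
    (¬ℓ IsLastTopF e es env ∧ℓ atom (varL zero ≡q constL (+ 0)))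

  SumF : List (Lin m) → Lin k → (Fin m → Lin k) → LinFormula k
  SumF []       total env = atom (total ≡q constL (+ 0))
  SumF (e ∷ es) total env =
    ∃ℓ (ContributionF e es (wkEnv env) ∧ℓ SumF es (wkL total -L varL zero) (wkEnv env))

  countFormula : LinFormula (suc m)
  countFormula = BoundedF (varL ∘ suc) ∧ℓ SumF (candidates (boundaryPoints θ) d) (varL zero) (varL ∘ suc)

within⇒InRange : ∀ {y L} → y ≤ L → - L ≤ y → InRange (- L) (suc (∣ L ∣ ℕ.+ ∣ L ∣)) y
within⇒InRange {y} {L} y≤L -L≤y =
  -L≤y , <-from-slack _ (slack y L (+ ∣ L ∣)) (NonNeg-+ (≤⇒NonNeg y≤L) (NonNeg-+ (NonNeg-∣∣- L) (NonNeg-∣∣- L)))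
  where slack : ∀ y L a → (L - y) + ((a - L) + (a - L)) ≡ - L + (+ 1 + (a + a)) - y - + 1
        slack = solve-∀

∣∣≤⇒within : ∀ {y B} → ∣ y ∣ ℕ.≤ B → y ≤ + B × - + B ≤ y
∣∣≤⇒within {+ k}      {B} k≤B = +≤+ k≤B , ≤-from-slack (+ k + + B) (slack (+ k) (+ B)) (NonNeg-ℕ (k ℕ.+ B))
  where slack : ∀ k B → k + B ≡ k - - B
        slack = solve-∀
∣∣≤⇒within { -[1+ k ]} {B} k<B = -≤+ , ≤-from-slack (+ B - + suc k) (slack (+ suc k) (+ B)) (≤⇒NonNeg (+≤+ k<B))
  where slack : ∀ a B → B - a ≡ (- a) - - B
        slack = solve-∀

∑∣∣ : List ℤ → ℕ
∑∣∣ []       = 0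
∑∣∣ (x ∷ xs) = ∣ x ∣ ℕ.+ ∑∣∣ xs

∈⇒∣∣≤∑∣∣ : ∀ {y} xs → y ∈ xs → ∣ y ∣ ℕ.≤ ∑∣∣ xs
∈⇒∣∣≤∑∣∣ (x ∷ xs) (here refl) = ℕ.m≤m+n _ _
∈⇒∣∣≤∑∣∣ (x ∷ xs) (there y∈)  = ℕ.≤-trans (∈⇒∣∣≤∑∣∣ xs y∈) (ℕ.m≤n+m _ _)

countIs-bounded : ∀ {P : ℤ → Set} → (∀ y → Dec (P y)) → ∀ B → (∀ y → P y → ∣ y ∣ ℕ.≤ B) → ∃ (CountIs P)
countIs-bounded P? B bounded =
  _ , countIs-enumerate P? _ _ λ y p → let (y≤B , -B≤y) = ∣∣≤⇒within (bounded y p) in within⇒InRange y≤B -B≤y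

module CountFormula-correct {m} (θ : QF (suc m)) (d : ℕ) (ρ : Val m) where
  open CountFormula θ d

  P : ℤ → Set
  P y = ⟦ θ ⟧q (y ∷ᵥ ρ)

  P? : ∀ y → Dec (P y)
  P? y = ⟦ θ ⟧q? (y ∷ᵥ ρ)

  open Runs P? d hiding (D)

  record EnvOK (env : Fin m → Lin k) (σ : Val k) : Set where
    constructor envOK
    field evalL-env : ∀ i → evalL (env i) σ ≡ ρ i

  module _ {env : Fin m → Lin k} {σ : Val k} (env-ok : EnvOK env σ) where

    EnvOK-wk : ∀ a → EnvOK (wkEnv env) (a ∷ᵥ σ)
    EnvOK-wk a = envOK λ i → trans (evalL-wk (env i) a σ) (EnvOK.evalL-env env-ok i)

    evalL-substL : ∀ e → evalL (substL e env) σ ≡ evalL e ρ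
    evalL-substL e = trans (evalL-subst e env σ) (evalL-cong e (EnvOK.evalL-env env-ok))

    at-correct : ∀ e {y} → evalL e σ ≡ y → ⟦ e at env ⟧q σ ⇔ P y
    at-correct e refl = ⟦⟧q-cong θ pointwise ⇔-∘ substQ-correct θ (extend e env) σ
      where
        pointwise : ∀ i → evalL (extend e env i) σ ≡ (evalL e σ ∷ᵥ ρ) i
        pointwise zero    = refl
        pointwise (suc i) = EnvOK.evalL-env env-ok i

  evalL--D· : ∀ (e c : Lin k) σ → evalL (e -D· c) σ ≡ evalL e σ - evalL c σ * D
  evalL--D· e c σ =
    trans (evalL-+ e _ σ) (trans (cong (_+_ (evalL e σ)) (evalL-* (- D) c σ)) (lemma (evalL e σ) (evalL c σ) D))
    where lemma : ∀ e c D → e + (- D) * c ≡ e - c * D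
          lemma = solve-∀

  var₀ : ∀ a (σ : Val k) → evalL (varL zero) (a ∷ᵥ σ) ≡ a
  var₀ a σ = evalL-var zero (a ∷ᵥ σ)

  BoundedF-correct : ∀ {env : Fin m → Lin k} {σ} → EnvOK env σ →
                     ⟦ BoundedF env ⟧ℓ σ ⇔ (∃ λ L → ∀ y → P y → y ≤ L × - L ≤ y)
  BoundedF-correct {env = env} {σ} env-ok = ∃-cong-⇔ λ L → Π-cong-⇔ λ y →
    let σ′ = y ∷ᵥ (L ∷ᵥ σ) in
    →-cong-⇔ (at-correct (EnvOK-wk (EnvOK-wk env-ok L) y) (varL zero) (var₀ y (L ∷ᵥ σ)))
      (cong₂-⇔ _≤_ (var₀ y (L ∷ᵥ σ)) (evalL-var (suc zero) σ′) ⇔-∘ ≤q-correct (varL zero) (varL (suc zero)) σ′ ×-⇔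
       cong₂-⇔ _≤_ (trans (evalL-* -[1+ 0 ] (varL (suc zero)) σ′)
                       (trans (cong (-[1+ 0 ] *_) (evalL-var (suc zero) σ′)) (ℤ.-1*i≡-i L)))
                (var₀ y (L ∷ᵥ σ))
       ⇔-∘ ≤q-correct (-[1+ 0 ] *L varL (suc zero)) (varL zero) σ′)

  distinctFrom-correct : ∀ {env : Fin m → Lin k} {σ} → EnvOK env σ → ∀ e es →
    ⟦ distinctFrom (substL e env) (map (λ t → substL t env) es) ⟧q σ ⇔ evalL e ρ ∉ values ρ es
  distinctFrom-correct env-ok e []       = mk⇔ (λ _ ()) (λ _ → tt)
  distinctFrom-correct {env = env} {σ} env-ok e (t ∷ es) =
    ∉-∷-⇔ ⇔-∘ ((¬-cong-⇔ (cong₂-⇔ _≡_ (evalL-substL env-ok e) (evalL-substL env-ok t)) ⇔-∘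
                ≢q-correct (substL e env) (substL t env) σ)
               ×-⇔ distinctFrom-correct env-ok e es)

  IsLastTop : ℤ → List ℤ → Set
  IsLastTop v vs = v ∉ vs × P v × ¬ P (v + D)

  IsLastTop? : ∀ v vs → Dec (IsLastTop v vs)
  IsLastTop? v vs = ¬? (v ∈? vs) ×-dec P? v ×-dec ¬? (P? (v + D))

  IsLastTopF-correct : ∀ {env : Fin m → Lin k} {σ} → EnvOK env σ → ∀ e es →
                       ⟦ IsLastTopF e es env ⟧ℓ σ ⇔ IsLastTop (evalL e ρ) (values ρ es)
  IsLastTopF-correct {env = env} {σ} env-ok e es =
    distinctFrom-correct env-ok e es ×-⇔
    at-correct env-ok (substL e env) (evalL-substL env-ok e) ×-⇔
    ¬-cong-⇔ (at-correct env-ok (substL e env +L constL D)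
                (trans (evalL-+ (substL e env) _ σ) (cong₂ _+_ (evalL-substL env-ok e) (evalL-const D σ))))

  IsRunLengthF-correct : ∀ {env : Fin m → Lin k} {σ} → EnvOK env σ → ∀ e c →
                         ⟦ IsRunLengthF e c env ⟧ℓ σ ⇔ IsRunLength (evalL e σ) (evalL c σ)
  IsRunLengthF-correct {env = env} {σ} env-ok e c =
    cong₂-⇔ _≤_ (evalL-const (+ 0) σ) refl ⇔-∘ ≤q-correct (constL (+ 0)) c σ ×-⇔
    Π-cong-⇔ (λ j → →-cong-⇔ (range⇔ j) (at-correct (EnvOK-wk env-ok j) (wkL e -D· varL zero) (point≡ j))) ×-⇔
    ¬-cong-⇔ (at-correct env-ok (e -D· c) (evalL--D· e c σ))
    where
      range⇔ : ∀ j → ⟦ constL (+ 0) ≤q varL zero ∧q varL zero <q wkL c ⟧q (j ∷ᵥ σ) ⇔ (NonNeg j × j < evalL c σ)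
      range⇔ j = (cong₂-⇔ _≤_ (evalL-const (+ 0) (j ∷ᵥ σ)) (var₀ j σ)
                   ⇔-∘ ≤q-correct (constL (+ 0)) (varL zero) (j ∷ᵥ σ)) ×-⇔
                 (cong₂-⇔ _<_ (var₀ j σ) (evalL-wk c j σ) ⇔-∘ <q-correct (varL zero) (wkL c) (j ∷ᵥ σ))
      point≡ : ∀ j → evalL (wkL e -D· varL zero) (j ∷ᵥ σ) ≡ evalL e σ - j * D
      point≡ j = trans (evalL--D· (wkL e) (varL zero) (j ∷ᵥ σ)) (cong₂ (λ a b → a - b * D) (evalL-wk e j σ) (var₀ j σ))

  module _ (lo : ℤ) (n : ℕ) (bounded : ∀ y → P y → InRange lo n y) where
    open Bounded lo n bounded

    contribution : ℤ → List ℤ → ℕ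
    contribution v vs = if does (v ∈? vs) then 0 else topRun cap v

    contribution-lastTop : ∀ {v vs} → IsLastTop v vs → contribution v vs ≡ run cap v
    contribution-lastTop {v} {vs} (v∉vs , p , ¬p⁺) with v ∈? vs
    ... | yes v∈vs = ⊥-elim (v∉vs v∈vs)
    ... | no  _    = topRun-top cap p ¬p⁺

    contribution-notLastTop : ∀ {v vs} → ¬ IsLastTop v vs → contribution v vs ≡ 0
    contribution-notLastTop {v} {vs} ¬top with v ∈? vs
    ... | yes _    = refl
    ... | no  v∉vs = topRun-notTop cap λ (p , ¬p⁺) → ¬top (v∉vs , p , ¬p⁺)

    ContributionF-correct : ∀ {env : Fin m → Lin (suc k)} {c σ} → EnvOK env (c ∷ᵥ σ) → ∀ e es →
      ⟦ ContributionF e es env ⟧ℓ (c ∷ᵥ σ) ⇔ c ≡ + contribution (evalL e ρ) (values ρ es)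
    ContributionF-correct {env = env} {c} {σ} env-ok e es = by-cases (IsLastTop? v vs)
      where
        v = evalL e ρ
        vs = values ρ es
        top⇔ = IsLastTopF-correct env-ok e es
        runLength⇔ : ⟦ IsRunLengthF (substL e env) (varL zero) env ⟧ℓ (c ∷ᵥ σ) ⇔ IsRunLength v c
        runLength⇔ = cong₂-⇔ IsRunLength (evalL-substL env-ok e) (var₀ c σ)
                     ⇔-∘ IsRunLengthF-correct env-ok (substL e env) (varL zero)
        zero⇔ : ⟦ varL zero ≡q constL (+ 0) ⟧q (c ∷ᵥ σ) ⇔ c ≡ + 0
        zero⇔ = cong₂-⇔ _≡_ (var₀ c σ) (evalL-const (+ 0) (c ∷ᵥ σ))
                ⇔-∘ ≡q-correct (varL zero) (constL (+ 0)) (c ∷ᵥ σ)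
        by-cases : Dec (IsLastTop v vs) → ⟦ ContributionF e es env ⟧ℓ (c ∷ᵥ σ) ⇔ c ≡ + contribution v vs
        by-cases (yes top) = mk⇔
          (λ { (inj₁ (_ , isRun)) → trans (to run⇔ (to runLength⇔ isRun)) (cong +_ (sym (contribution-lastTop top)))
             ; (inj₂ (¬top , _))  → ⊥-elim (¬top (from top⇔ top)) })
          (λ c≡ → inj₁ (from top⇔ top , from runLength⇔ (from run⇔ (trans c≡ (cong +_ (contribution-lastTop top))))))
          where run⇔ = IsRunLength⇔ cap v c (below-after-cap (proj₁ (proj₂ top)))
        by-cases (no ¬top) = mk⇔
          (λ { (inj₁ (top , _)) → ⊥-elim (¬top (to top⇔ top))
             ; (inj₂ (_ , c≡0))  → trans (to zero⇔ c≡0) (cong +_ (sym (contribution-notLastTop ¬top))) })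
          (λ c≡ → inj₂ (¬top ∘ to top⇔ , from zero⇔ (trans c≡ (cong +_ (contribution-notLastTop ¬top)))))

    SumF-correct : ∀ {env : Fin m → Lin k} {σ} → EnvOK env σ → ∀ es total →
                   ⟦ SumF es total env ⟧ℓ σ ⇔ evalL total σ ≡ + ∑distinct (topRun cap) (values ρ es)
    SumF-correct {σ = σ} env-ok [] total =
      cong₂-⇔ _≡_ refl (evalL-const (+ 0) σ) ⇔-∘ ≡q-correct total (constL (+ 0)) σ
    SumF-correct {env = env} {σ} env-ok (e ∷ es) total = mk⇔
      (λ (c , contr , rest) → trans (split t c) (cong₂ _+_ (to (contribution⇔ c) contr) (to (rest⇔ c) rest)))
      (λ t≡ → + c₀ , from (contribution⇔ (+ c₀)) refl ,
              from (rest⇔ (+ c₀)) (trans (cong (_- + c₀) t≡) (cancel (+ c₀) (+ S))))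
      where
        t = evalL total σ
        c₀ = contribution (evalL e ρ) (values ρ es)
        S = ∑distinct (topRun cap) (values ρ es)
        contribution⇔ : ∀ c → ⟦ ContributionF e es (wkEnv env) ⟧ℓ (c ∷ᵥ σ) ⇔ c ≡ + c₀
        contribution⇔ c = ContributionF-correct (EnvOK-wk env-ok c) e es
        rest⇔ : ∀ c → ⟦ SumF es (wkL total -L varL zero) (wkEnv env) ⟧ℓ (c ∷ᵥ σ) ⇔ t - c ≡ + S
        rest⇔ c = cong₂-⇔ _≡_ (trans (evalL-- (wkL total) (varL zero) (c ∷ᵥ σ))
                                     (cong₂ _-_ (evalL-wk total c σ) (var₀ c σ))) refl
                  ⇔-∘ SumF-correct (EnvOK-wk env-ok c) es _
        split : ∀ t c → t ≡ c + (t - c)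
        split = solve-∀
        cancel : ∀ a b → a + b - a ≡ b
        cancel = solve-∀

  tops∈candidates : ModuliDivide (+ suc d) θ → Normalised θ →
                    ∀ e → P e → ¬ P (e + D) → e ∈ values ρ (candidates (boundaryPoints θ) d)
  tops∈candidates θ∣D θn e p ¬p⁺ with step-or-nearBoundary d θ e ρ θ∣D θn p
  ... | inj₁ p⁺  = ⊥-elim (¬p⁺ p⁺)
  ... | inj₂ near = nearBoundary⇒candidate d θ near

  countFormula-correct : ModuliDivide (+ suc d) θ → Normalised θ →
                         ∀ b → ⟦ countFormula ⟧ℓ (b ∷ᵥ ρ) ⇔ CountIs P b
  countFormula-correct θ∣D θn b = mk⇔ to′ from′
    where
      params-ok : EnvOK (varL ∘ suc) (b ∷ᵥ ρ)
      params-ok = envOK λ i → evalL-var (suc i) (b ∷ᵥ ρ)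
      total⇔ : ∀ lo n bounded → ⟦ SumF (candidates (boundaryPoints θ) d) (varL zero) (varL ∘ suc) ⟧ℓ (b ∷ᵥ ρ) ⇔
                                 b ≡ + ∑from lo n (𝟙 ∘ P?)
      total⇔ lo n bounded =
        cong₂-⇔ _≡_ (var₀ b ρ) (cong +_ (sym (Bounded.count-by-tops lo n bounded _ (tops∈candidates θ∣D θn))))
        ⇔-∘ SumF-correct lo n bounded params-ok (candidates (boundaryPoints θ) d) (varL zero)
      to′ : ⟦ countFormula ⟧ℓ (b ∷ᵥ ρ) → CountIs P b
      to′ (bnd , sum) = subst (CountIs P) (sym (to (total⇔ _ _ bounded) sum)) (countIs-enumerate P? _ _ bounded)
        where
          within = proj₂ (to (BoundedF-correct params-ok) bnd)
          bounded = λ y p → within⇒InRange (proj₁ (within y p)) (proj₂ (within y p))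
      from′ : CountIs P b → ⟦ countFormula ⟧ℓ (b ∷ᵥ ρ)
      from′ cnt@(xs , _ , xs⇔ , _) =
        from (BoundedF-correct params-ok) (+ B , within) ,
        from (total⇔ _ _ bounded) (CountIs-unique cnt (countIs-enumerate P? _ _ bounded))
        where
          B = ∑∣∣ xs
          within : ∀ y → P y → y ≤ + B × - + B ≤ y
          within y p = ∣∣≤⇒within (∈⇒∣∣≤∑∣∣ xs (proj₁ (xs⇔ y) p))
          bounded = λ y p → within⇒InRange (proj₁ (within y p)) (proj₂ (within y p))

-- Counting is invariant under x ↦ (l + 1)·x

CountIs-cong : ∀ {P Q : ℤ → Set} {b} → (∀ y → P y ⇔ Q y) → CountIs P b → CountIs Q b
CountIs-cong P⇔Q (xs , xs! , xs⇔ , b≡) =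
  xs , xs! , (λ a → (proj₁ (xs⇔ a) ∘ from (P⇔Q a)) , (to (P⇔Q a) ∘ proj₂ (xs⇔ a))) , b≡

module _ {P Q : ℤ → Set} (l : ℕ) (Q⇔ : ∀ y → Q y ⇔ (∃ λ x → y ≡ + suc l * x × P x)) where

  CountIs-scale : ∀ {b} → CountIs P b → CountIs Q b
  CountIs-scale (xs , xs! , xs⇔ , b≡) =
    map (+ suc l *_) xs , map⁺ (ℤ.*-cancelˡ-≡ (+ suc l) _ _) xs! , members ,
    trans b≡ (cong +_ (sym (List.length-map _ xs)))
    where
      members : ∀ a → (Q a → a ∈ map (+ suc l *_) xs) × (a ∈ map (+ suc l *_) xs → Q a)
      members a =
        (λ q → let (x , a≡ , p) = to (Q⇔ a) q in subst (_∈ _) (sym a≡) (∈-map⁺ (+ suc l *_) (proj₁ (xs⇔ x) p))) ,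
        (λ a∈ → let (x , x∈ , a≡) = ∈-map⁻ (+ suc l *_) a∈ in from (Q⇔ a) (x , a≡ , proj₂ (xs⇔ x) x∈))

  CountIs-unscale : (∀ y → Dec (P y)) → ∀ {b} → CountIs Q b → CountIs P b
  CountIs-unscale P? {b} cq@(ys , _ , ys⇔ , _) =
    let (_ , cp) = countIs-bounded P? (∑∣∣ ys) bounded
    in subst (CountIs P) (sym (CountIs-unique cq (CountIs-scale cp))) cp
    where
      bounded : ∀ x → P x → ∣ x ∣ ℕ.≤ ∑∣∣ ys
      bounded x p = ℕ.≤-trans (subst (∣ x ∣ ℕ.≤_) (sym (ℤ.abs-* (+ suc l) x)) (ℕ.m≤n*m ∣ x ∣ (suc l)))
                              (∈⇒∣∣≤∑∣∣ ys (proj₁ (ys⇔ _) (from (Q⇔ _) (x , refl , p))))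

theorem1 : (m : ℕ) (φ : Formula (suc m)) →
    Σ (Formula (suc m)) λ ψ →
      (as : Val m) (b : ℤ) →
        (⟦ ψ ⟧ (as ∷ʳᵥ b) → CountQ φ as b) × (CountQ φ as b → ⟦ ψ ⟧ (as ∷ʳᵥ b))
theorem1 m φ = closeFormula m countFormula , λ as b → to (count⇔ as b) , from (count⇔ as b)
  where
    θ = moveLastToFront m (qe (fromFormula φ))
    θ′ = unitForm θ
    d = modulus θ′
    open CountFormula θ′ d using (countFormula)
    θ⇔φ : ∀ as x → ⟦ θ ⟧q (x ∷ᵥ as) ⇔ ⟦ φ ⟧ (as ∷ʳᵥ x)
    θ⇔φ as x =
      fromFormula-correct φ _ ⇔-∘ (⇔-sym (qe-correct (fromFormula φ) _) ⇔-∘ moveLastToFront-correct m _ as x)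
    count⇔ : ∀ as b → ⟦ closeFormula m countFormula ⟧ (as ∷ʳᵥ b) ⇔ CountQ φ as b
    count⇔ as b = begin
      ⟦ closeFormula m countFormula ⟧ (as ∷ʳᵥ b)
        ∼⟨ closeFormula-correct m countFormula as b ⟩
      ⟦ countFormula ⟧ℓ (b ∷ᵥ as)
        ∼⟨ CountFormula-correct.countFormula-correct θ′ d as (moduliDivide-modulus θ′) (unitForm-normalised θ) b ⟩
      CountIs (λ y → ⟦ θ′ ⟧q (y ∷ᵥ as)) b
        ∼⟨ mk⇔ (CountIs-unscale (scale θ) unscaled (λ x → ⟦ θ ⟧q? (x ∷ᵥ as))) (CountIs-scale (scale θ) unscaled) ⟩
      CountIs (λ x → ⟦ θ ⟧q (x ∷ᵥ as)) b
        ∼⟨ mk⇔ (CountIs-cong (θ⇔φ as)) (CountIs-cong (⇔-sym ∘ θ⇔φ as)) ⟩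
      CountQ φ as b ∎
      where
        open EquationalReasoning
        unscaled = λ y → unitForm-correct θ y as
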